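{- $$Q_{132}^{(0,0,\emptyset,0)}(t,x)=\frac{(1+t-tx)-\sqrt{(1+t-tx)^2-4t}}{2t}.$$ For $k\ge1$, $$Q_{132}^{(k,0,\emptyset,0)}(t,x)=\frac{1}{1-t\,Q_{132}^{(k-1,0,\emptyset,0)}(t,x)}.$$ Consequently $Q_{132}^{(0,0,\emptyset,0)}(t,0)=1$ and for $k\ge1$, $Q_{132}^{(k,0,\emptyset,0)}(t,0)=\frac{1}{1-t\,Q_{132}^{(k-1,0,\emptyset,0)}(t,0)}$.
   Context: For $\sigma=\sigma_1\cdots\sigma_n\in S_n$ and $k\in\mathbb{N}$, $\mathrm{mmp}^{(k,0,\emptyset,0)}(\sigma)$ is the number of positions $i$ such that there are at least $k$ indices $j>i$ with $\sigma_j>\sigma_i$ and there is no $j<i$ with $\sigma_j<\sigma_i$ (so for $k=0$ it counts left-to-right minima). $S_n(132)$ is the set of 132-avoiding permutations of $[n]$. $Q_{n,132}^{(k,0,\emptyset,0)}(x)=\sum_{\sigma\in S_n(132)}x^{\mathrm{mmp}^{(k,0,\emptyset,0)}(\sigma)}$ and $Q_{132}^{(k,0,\emptyset,0)}(t,x)=1+\sum_{n\ge1}t^nQ_{n,132}^{(k,0,\emptyset,0)}(x)$ as a formal power series in $t$; the square root is the formal power series in $t$ with constant term $1$. -}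

module Defs where

open import Data.Nat as ℕ using (ℕ; zero; suc; _<ᵇ_; _≤ᵇ_; _≡ᵇ_)
open import Data.Bool using (Bool; true; false; _∧_; _∨_; not; if_then_else_)
open import Data.List using (List; []; _∷_; _++_; [_]; length; filter; upTo; map; concatMap)
open import Data.Bool.ListAction using (any)
open import Data.Integer as ℤ using (ℤ)
open import Relation.Binary.PropositionalEquality using (_≡_)
open import Relation.Nullary.Decidable using (Dec)
open import Data.Bool.Properties using () renaming (_≟_ to _≟B_)

-- Permutations of [n] = {1,…,n} as words σ₁⋯σₙ (lists of naturals).

words : ℕ → ℕ → List (List ℕ)
words n zero    = [] ∷ []
words n (suc k) = concatMap (λ a → map (a ∷_) (words n k)) (map suc (upTo n))

distinct : List ℕ → Bool
distinct []       = true
distinct (a ∷ as) = not (any (λ b → a ≡ᵇ b) as) ∧ distinct as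

S : ℕ → List (List ℕ)
S n = filter (λ σ → distinct σ ≟B true) (words n n)

-- 132-pattern: indices i<j<k with σ_i < σ_k < σ_j

has21above : ℕ → List ℕ → Bool
has21above a []       = false
has21above a (b ∷ bs) = ((a <ᵇ b) ∧ any (λ c → (a <ᵇ c) ∧ (c <ᵇ b)) bs) ∨ has21above a bs

contains132 : List ℕ → Bool
contains132 []       = false
contains132 (a ∷ as) = has21above a as ∨ contains132 as

S132 : ℕ → List (List ℕ)
S132 n = filter (λ σ → contains132 σ ≟B false) (S n)

-- mmp^{(k,0,∅,0)}(σ): number of positions i with at least k indices j>i
-- with σ_j > σ_i and no j<i with σ_j < σ_i.

mmpGo : ℕ → List ℕ → List ℕ → ℕ
mmpGo k before []       = 0
mmpGo k before (a ∷ as) =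
  (if (k ≤ᵇ length (filter (λ c → a ℕ.<? c) as)) ∧ not (any (λ c → c <ᵇ a) before)
   then 1 else 0)
  ℕ.+ mmpGo k (before ++ [ a ]) as

mmp : ℕ → List ℕ → ℕ
mmp k σ = mmpGo k [] σ

-- Formal power series in t with coefficients in ℤ[x]:
-- F n m = coefficient of t^n x^m.

PS : Set
PS = ℕ → ℕ → ℤ

infix 4 _≈_
_≈_ : PS → PS → Set
F ≈ G = ∀ n m → F n m ≡ G n m

δ : ℕ → ℤ
δ zero    = ℤ.1ℤ
δ (suc _) = ℤ.0ℤ

one : PS
one n m = δ n ℤ.* δ m

δ₁ : ℕ → ℤ
δ₁ zero    = ℤ.0ℤ
δ₁ (suc i) = δ i

tS : PS
tS n m = δ₁ n ℤ.* δ m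

xS : PS
xS n m = δ n ℤ.* δ₁ m

infixl 6 _⊕_ _⊖_
infixl 7 _⊛_

_⊕_ : PS → PS → PS
(F ⊕ G) n m = F n m ℤ.+ G n m

_⊖_ : PS → PS → PS
(F ⊖ G) n m = F n m ℤ.- G n m

Σ≤ : ℕ → (ℕ → ℤ) → ℤ
Σ≤ zero    f = f 0
Σ≤ (suc n) f = Σ≤ n f ℤ.+ f (suc n)

_⊛_ : PS → PS → PS
(F ⊛ G) n m = Σ≤ n (λ i → Σ≤ m (λ j → F i j ℤ.* G (n ℕ.∸ i) (m ℕ.∸ j)))

two : PS
two = one ⊕ one

atx0 : PS → PS
atx0 F n m = F n 0 ℤ.* δ m

-- Q_{132}^{(k,0,∅,0)}(t,x): coefficient of t^n x^m is the number of
-- σ ∈ S_n(132) with mmp^{(k,0,∅,0)}(σ) = m  (n = 0 gives the leading 1).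

Q : ℕ → PS
Q k n m = ℤ.+ length (filter (λ σ → mmp k σ ℕ.≟ m) (S132 n))

-- Every σ ∈ S_{n+1}(132) is uniquely σ = σ′ (n+1) σ″ where, for j = |σ″|,
-- σ″ is a 132-avoiding arrangement of {1,…,j} and σ′ one of {j+1,…,n}
-- (an entry before n+1 below an entry after it would form a 132), and
-- every such pair arises.  For such σ,
--   mmp_k(σ) = mmp_{k-1}(σ′) + [k = 0 and σ′ = ∅] + mmp_k(σ″),
-- so Q_k = 1 + t·P_k·Q_k with P_{k+1} = Q_k and P_0 = Q_0 - 1 + x.  The
-- first case gives Q_{k+1}·(1 - t·Q_k) = 1.  The second says
-- t·Q_0² - b·Q_0 + 1 = 0 for b = 1 + t - tx, so b - 2t·Q_0 is a square root
-- of b² - 4t with constant term 1.  Setting x = 0 is a ring homomorphism,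
-- and Q_0(t,0) = 1 because every nonempty permutation starts with a
-- left-to-right minimum.

module Submission where

open import Defs
open import Data.Nat using (ℕ; suc)
open import Data.Product using (_×_; ∃; _,_)
open import Relation.Binary.PropositionalEquality using (_≡_)

module Sums where

  open import Defs using (Σ≤; δ)
  open import Data.Nat as ℕ using (ℕ; zero; suc; _∸_; z≤n)
  open import Data.Nat.Properties as ℕP using ()
  open import Data.Integer using (ℤ; _+_; _*_; 0ℤ)
  open import Data.Integer.Properties
  open import Data.Integer.Tactic.RingSolver using (solve-∀)
  open import Relation.Binary.PropositionalEquality
  open ≡-Reasoning

  Σ-cong : ∀ n {f g : ℕ → ℤ} → (∀ i → i ℕ.≤ n → f i ≡ g i) → Σ≤ n f ≡ Σ≤ n g
  Σ-cong zero    f≗g = f≗g 0 z≤n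
  Σ-cong (suc n) f≗g =
    cong₂ _+_ (Σ-cong n (λ i i≤n → f≗g i (ℕP.m≤n⇒m≤1+n i≤n))) (f≗g (suc n) ℕP.≤-refl)

  Σ-cong′ : ∀ n {f g : ℕ → ℤ} → (∀ i → f i ≡ g i) → Σ≤ n f ≡ Σ≤ n g
  Σ-cong′ n f≗g = Σ-cong n (λ i _ → f≗g i)

  private
    interchange : ∀ a b c d → (a + b) + (c + d) ≡ (a + c) + (b + d)
    interchange = solve-∀

  Σ-+ : ∀ n (f g : ℕ → ℤ) → Σ≤ n (λ i → f i + g i) ≡ Σ≤ n f + Σ≤ n g
  Σ-+ zero    f g = refl
  Σ-+ (suc n) f g = begin
    Σ≤ n (λ i → f i + g i) + (f (suc n) + g (suc n))
      ≡⟨ cong (_+ (f (suc n) + g (suc n))) (Σ-+ n f g) ⟩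
    (Σ≤ n f + Σ≤ n g) + (f (suc n) + g (suc n))
      ≡⟨ interchange (Σ≤ n f) (Σ≤ n g) (f (suc n)) (g (suc n)) ⟩
    Σ≤ (suc n) f + Σ≤ (suc n) g ∎

  Σ-*ˡ : ∀ n c (f : ℕ → ℤ) → c * Σ≤ n f ≡ Σ≤ n (λ i → c * f i)
  Σ-*ˡ zero    c f = refl
  Σ-*ˡ (suc n) c f = trans (*-distribˡ-+ c (Σ≤ n f) _) (cong (_+ c * f (suc n)) (Σ-*ˡ n c f))

  Σ-*ʳ : ∀ n c (f : ℕ → ℤ) → Σ≤ n f * c ≡ Σ≤ n (λ i → f i * c)
  Σ-*ʳ n c f = begin
    Σ≤ n f * c                ≡⟨ *-comm (Σ≤ n f) c ⟩
    c * Σ≤ n f                ≡⟨ Σ-*ˡ n c f ⟩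
    Σ≤ n (λ i → c * f i)      ≡⟨ Σ-cong′ n (λ i → *-comm c (f i)) ⟩
    Σ≤ n (λ i → f i * c)      ∎

  Σ-zero : ∀ n (f : ℕ → ℤ) → (∀ i → f i ≡ 0ℤ) → Σ≤ n f ≡ 0ℤ
  Σ-zero zero    f f≡0 = f≡0 0
  Σ-zero (suc n) f f≡0 = trans (cong₂ _+_ (Σ-zero n f f≡0) (f≡0 (suc n))) (+-identityʳ 0ℤ)

  Σ-swap : ∀ n m (f : ℕ → ℕ → ℤ) →
           Σ≤ n (λ i → Σ≤ m (λ j → f i j)) ≡ Σ≤ m (λ j → Σ≤ n (λ i → f i j))
  Σ-swap zero    m f = refl
  Σ-swap (suc n) m f = begin
    Σ≤ n (λ i → Σ≤ m (f i)) + Σ≤ m (f (suc n))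
      ≡⟨ cong (_+ Σ≤ m (f (suc n))) (Σ-swap n m f) ⟩
    Σ≤ m (λ j → Σ≤ n (λ i → f i j)) + Σ≤ m (f (suc n))
      ≡⟨ Σ-+ m _ _ ⟨
    Σ≤ m (λ j → Σ≤ n (λ i → f i j) + f (suc n) j) ∎

  Σ-head : ∀ n (f : ℕ → ℤ) → Σ≤ (suc n) f ≡ f 0 + Σ≤ n (λ i → f (suc i))
  Σ-head zero    f = refl
  Σ-head (suc n) f = trans (cong (_+ f (suc (suc n))) (Σ-head n f)) (+-assoc (f 0) _ _)

  Σ-reverse : ∀ n (f : ℕ → ℤ) → Σ≤ n f ≡ Σ≤ n (λ i → f (n ∸ i))
  Σ-reverse zero    f = refl
  Σ-reverse (suc n) f = begin
    Σ≤ (suc n) f                           ≡⟨ Σ-head n f ⟩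
    f 0 + Σ≤ n (λ i → f (suc i))           ≡⟨ +-comm (f 0) _ ⟩
    Σ≤ n (λ i → f (suc i)) + f 0           ≡⟨ cong (_+ f 0) (Σ-reverse n (λ i → f (suc i))) ⟩
    Σ≤ n (λ i → f (suc (n ∸ i))) + f 0
      ≡⟨ cong₂ _+_ (Σ-cong n (λ i i≤n → cong f (sym (ℕP.+-∸-assoc 1 i≤n))))
                   (cong f (sym (ℕP.n∸n≡0 n))) ⟩
    Σ≤ (suc n) (λ i → f (suc n ∸ i))       ∎

  Σ-triangle : ∀ n (g : ℕ → ℕ → ℤ) →
    Σ≤ n (λ i → Σ≤ i (λ p → g p i)) ≡ Σ≤ n (λ p → Σ≤ (n ∸ p) (λ r → g p (p ℕ.+ r)))
  Σ-triangle zero    g = refl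
  Σ-triangle (suc n) g = begin
    Σ≤ n (λ i → Σ≤ i (λ p → g p i)) + Σ≤ (suc n) (λ p → g p (suc n))
      ≡⟨ cong (_+ Σ≤ (suc n) (λ p → g p (suc n))) (Σ-triangle n g) ⟩
    rows n + (Σ≤ n (λ p → g p (suc n)) + g (suc n) (suc n))
      ≡⟨ +-assoc (rows n) _ _ ⟨
    (rows n + Σ≤ n (λ p → g p (suc n))) + g (suc n) (suc n)
      ≡⟨ cong₂ _+_ (Σ-+ n _ _) (cong (g (suc n)) (ℕP.+-identityʳ (suc n))) ⟨
    Σ≤ n (λ p → row n p + g p (suc n)) + g (suc n) (suc n ℕ.+ 0)
      ≡⟨ cong₂ _+_ (Σ-cong n extend-row)
                   (cong (λ z → Σ≤ z (λ r → g (suc n) (suc n ℕ.+ r))) (sym (ℕP.n∸n≡0 n))) ⟩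
    rows (suc n) ∎
    where
    row : ℕ → ℕ → ℤ
    row n p = Σ≤ (n ∸ p) (λ r → g p (p ℕ.+ r))
    rows : ℕ → ℤ
    rows n = Σ≤ n (row n)
    extend-row : ∀ p → p ℕ.≤ n → row n p + g p (suc n) ≡ row (suc n) p
    extend-row p p≤n rewrite ℕP.+-∸-assoc 1 p≤n =
      cong (λ z → row n p + g p z)
        (trans (cong suc (sym (ℕP.m+[n∸m]≡n p≤n))) (sym (ℕP.+-suc p (n ∸ p))))

  Σ-δ : ∀ n (f : ℕ → ℤ) → Σ≤ n (λ i → δ i * f i) ≡ f 0
  Σ-δ zero    f = *-identityˡ (f 0)
  Σ-δ (suc n) f = trans (cong₂ _+_ (Σ-δ n f) (*-zeroˡ (f (suc n)))) (+-identityʳ _)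


-- Power series in t and x with integer coefficients form a commutative
-- ring; this provides a ring solver for identities between them.
module PowerSeries where

  open import Defs
  open Sums
  open import Data.Nat as ℕ using (ℕ; suc; _∸_)
  open import Data.Nat.Properties as ℕP using ()
  open import Data.Integer as ℤ using (ℤ; _+_; _*_; -_; 0ℤ)
  open import Data.Integer.Properties
  open import Data.Product using (_,_)
  open import Data.Maybe using (Maybe; just; nothing)
  open import Data.Integer.Tactic.RingSolver using (solve-∀)
  open import Relation.Nullary using (yes; no)
  open import Relation.Binary.PropositionalEquality
  open import Relation.Binary.Structures using (IsEquivalence)
  open import Algebra.Bundles using (CommutativeRing)
  open import Algebra.Structures _≈_ using (IsCommutativeRing)
  open import Algebra.Solver.Ring.AlmostCommutativeRing
    using (AlmostCommutativeRing; fromCommutativeRing; _-Raw-AlmostCommutative⟶_)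
  open ≡-Reasoning

  ≈-isEquivalence : IsEquivalence _≈_
  ≈-isEquivalence = record
    { refl  = λ n m → refl
    ; sym   = λ F≈G n m → sym (F≈G n m)
    ; trans = λ F≈G G≈H n m → trans (F≈G n m) (G≈H n m)
    }

  ≈-trans : ∀ {F G H} → F ≈ G → G ≈ H → F ≈ H
  ≈-trans = IsEquivalence.trans ≈-isEquivalence

  ⊛-cong : ∀ {F F′ G G′} → F ≈ F′ → G ≈ G′ → F ⊛ G ≈ F′ ⊛ G′
  ⊛-cong F≈F′ G≈G′ n m =
    Σ-cong′ n (λ i → Σ-cong′ m (λ j → cong₂ _*_ (F≈F′ i j) (G≈G′ (n ∸ i) (m ∸ j))))

  -- Commutativity: reverse both summation indices.
  ⊛-comm : ∀ F G → F ⊛ G ≈ G ⊛ F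
  ⊛-comm F G n m = begin
    Σ≤ n (λ i → Σ≤ m (λ j → F i j * G (n ∸ i) (m ∸ j)))
      ≡⟨ Σ-cong′ n (λ i → Σ-reverse m _) ⟩
    Σ≤ n (λ i → Σ≤ m (λ j → F i (m ∸ j) * G (n ∸ i) (m ∸ (m ∸ j))))
      ≡⟨ Σ-reverse n _ ⟩
    Σ≤ n (λ i → Σ≤ m (λ j → F (n ∸ i) (m ∸ j) * G (n ∸ (n ∸ i)) (m ∸ (m ∸ j))))
      ≡⟨ Σ-cong n (λ i i≤n → Σ-cong m (λ j j≤m → begin
           F (n ∸ i) (m ∸ j) * G (n ∸ (n ∸ i)) (m ∸ (m ∸ j))
             ≡⟨ cong₂ (λ a b → F (n ∸ i) (m ∸ j) * G a b) (ℕP.m∸[m∸n]≡n i≤n) (ℕP.m∸[m∸n]≡n j≤m) ⟩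
           F (n ∸ i) (m ∸ j) * G i j
             ≡⟨ *-comm (F (n ∸ i) (m ∸ j)) (G i j) ⟩
           G i j * F (n ∸ i) (m ∸ j) ∎)) ⟩
    Σ≤ n (λ i → Σ≤ m (λ j → G i j * F (n ∸ i) (m ∸ j))) ∎

  -- Associativity: both sides are the sum of F p q * G r s * H u v over all
  -- p + r + u = n, q + s + v = m; the triangle exchange turns one into the other.
  ⊛-assoc : ∀ F G H → (F ⊛ G) ⊛ H ≈ F ⊛ (G ⊛ H)
  ⊛-assoc F G H n m = begin
    Σ≤ n (λ i → Σ≤ m (λ j → Σ≤ i (λ p → Σ≤ j (λ q → F p q * G (i ∸ p) (j ∸ q))) * H (n ∸ i) (m ∸ j)))
      ≡⟨ Σ-cong′ n (λ i → Σ-cong′ m (λ j → expand-left i j)) ⟩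
    Σ≤ n (λ i → Σ≤ m (λ j → Σ≤ i (λ p → Σ≤ j (λ q → term p q i j))))
      ≡⟨ Σ-cong′ n (λ i → Σ-swap m i _) ⟩
    Σ≤ n (λ i → Σ≤ i (λ p → Σ≤ m (λ j → Σ≤ j (λ q → term p q i j))))
      ≡⟨ Σ-cong′ n (λ i → Σ-cong′ i (λ p → Σ-triangle m (λ q j → term p q i j))) ⟩
    Σ≤ n (λ i → Σ≤ i (λ p → Σ≤ m (λ q → Σ≤ (m ∸ q) (λ s → term p q i (q ℕ.+ s)))))
      ≡⟨ Σ-triangle n (λ p i → Σ≤ m (λ q → Σ≤ (m ∸ q) (λ s → term p q i (q ℕ.+ s)))) ⟩
    Σ≤ n (λ p → Σ≤ (n ∸ p) (λ r → Σ≤ m (λ q → Σ≤ (m ∸ q) (λ s → term p q (p ℕ.+ r) (q ℕ.+ s)))))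
      ≡⟨ Σ-cong′ n (λ p → Σ-swap (n ∸ p) m _) ⟩
    Σ≤ n (λ p → Σ≤ m (λ q → Σ≤ (n ∸ p) (λ r → Σ≤ (m ∸ q) (λ s → term p q (p ℕ.+ r) (q ℕ.+ s)))))
      ≡⟨ Σ-cong′ n (λ p → Σ-cong′ m (λ q → Σ-cong′ (n ∸ p) (λ r → Σ-cong′ (m ∸ q) (λ s → reindex p q r s)))) ⟩
    Σ≤ n (λ p → Σ≤ m (λ q → Σ≤ (n ∸ p) (λ r → Σ≤ (m ∸ q) (λ s → F p q * (G r s * H (n ∸ p ∸ r) (m ∸ q ∸ s))))))
      ≡⟨ Σ-cong′ n (λ p → Σ-cong′ m (λ q → expand-right p q)) ⟨
    Σ≤ n (λ p → Σ≤ m (λ q → F p q * Σ≤ (n ∸ p) (λ r → Σ≤ (m ∸ q) (λ s → G r s * H (n ∸ p ∸ r) (m ∸ q ∸ s))))) ∎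
    where
    term : ℕ → ℕ → ℕ → ℕ → ℤ
    term p q i j = F p q * G (i ∸ p) (j ∸ q) * H (n ∸ i) (m ∸ j)

    expand-left : ∀ i j → Σ≤ i (λ p → Σ≤ j (λ q → F p q * G (i ∸ p) (j ∸ q))) * H (n ∸ i) (m ∸ j)
                        ≡ Σ≤ i (λ p → Σ≤ j (λ q → term p q i j))
    expand-left i j = trans (Σ-*ʳ i (H (n ∸ i) (m ∸ j)) _) (Σ-cong′ i (λ p → Σ-*ʳ j (H (n ∸ i) (m ∸ j)) _))

    expand-right : ∀ p q →
      F p q * Σ≤ (n ∸ p) (λ r → Σ≤ (m ∸ q) (λ s → G r s * H (n ∸ p ∸ r) (m ∸ q ∸ s)))
      ≡ Σ≤ (n ∸ p) (λ r → Σ≤ (m ∸ q) (λ s → F p q * (G r s * H (n ∸ p ∸ r) (m ∸ q ∸ s))))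
    expand-right p q = trans (Σ-*ˡ (n ∸ p) (F p q) _) (Σ-cong′ (n ∸ p) (λ r → Σ-*ˡ (m ∸ q) (F p q) _))

    reindex : ∀ p q r s → term p q (p ℕ.+ r) (q ℕ.+ s) ≡ F p q * (G r s * H (n ∸ p ∸ r) (m ∸ q ∸ s))
    reindex p q r s rewrite ℕP.m+n∸m≡n p r | ℕP.m+n∸m≡n q s | ℕP.∸-+-assoc n p r | ℕP.∸-+-assoc m q s =
      *-assoc (F p q) _ _

  ⊛-distribˡ : ∀ F G H → F ⊛ (G ⊕ H) ≈ F ⊛ G ⊕ F ⊛ H
  ⊛-distribˡ F G H n m =
    trans (Σ-cong′ n (λ i → trans (Σ-cong′ m (λ j → *-distribˡ-+ (F i j) _ _)) (Σ-+ m _ _)))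
          (Σ-+ n _ _)

  ⊛-identityˡ : ∀ G → one ⊛ G ≈ G
  ⊛-identityˡ G n m = begin
    Σ≤ n (λ i → Σ≤ m (λ j → (δ i * δ j) * G (n ∸ i) (m ∸ j)))
      ≡⟨ Σ-cong′ n (λ i → trans (Σ-cong′ m (λ j → *-assoc (δ i) (δ j) _)) (sym (Σ-*ˡ m (δ i) _))) ⟩
    Σ≤ n (λ i → δ i * Σ≤ m (λ j → δ j * G (n ∸ i) (m ∸ j)))
      ≡⟨ Σ-δ n _ ⟩
    Σ≤ m (λ j → δ j * G n (m ∸ j))
      ≡⟨ Σ-δ m _ ⟩
    G n m ∎

  PS-isCommutativeRing : IsCommutativeRing _⊕_ _⊛_ (λ F n m → - F n m) (λ _ _ → 0ℤ) one
  PS-isCommutativeRing = record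
    { isRing = record
      { +-isAbelianGroup = record
        { isGroup = record
          { isMonoid = record
            { isSemigroup = record
              { isMagma = record
                { isEquivalence = ≈-isEquivalence
                ; ∙-cong = λ F≈F′ G≈G′ n m → cong₂ _+_ (F≈F′ n m) (G≈G′ n m) }
              ; assoc = λ F G H n m → +-assoc (F n m) (G n m) (H n m) }
            ; identity = (λ F n m → +-identityˡ (F n m)) , (λ F n m → +-identityʳ (F n m)) }
          ; inverse = (λ F n m → +-inverseˡ (F n m)) , (λ F n m → +-inverseʳ (F n m))
          ; ⁻¹-cong = λ F≈G n m → cong -_ (F≈G n m) }
        ; comm = λ F G n m → +-comm (F n m) (G n m) }
      ; *-cong = ⊛-cong
      ; *-assoc = ⊛-assoc
      ; *-identity = ⊛-identityˡ , (λ G → ≈-trans (⊛-comm G one) (⊛-identityˡ G))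
      ; distrib = ⊛-distribˡ , ⊛-distribʳ }
    ; *-comm = ⊛-comm }
    where
    ⊛-distribʳ : ∀ F G H → (G ⊕ H) ⊛ F ≈ G ⊛ F ⊕ H ⊛ F
    ⊛-distribʳ F G H = ≈-trans (⊛-comm (G ⊕ H) F) (≈-trans (⊛-distribˡ F G H)
      (λ n m → cong₂ _+_ (⊛-comm F G n m) (⊛-comm F H n m)))

  PS-commutativeRing : CommutativeRing _ _
  PS-commutativeRing = record { isCommutativeRing = PS-isCommutativeRing }

  -- The constant series c.  Multiplication by 1 is special-cased so that the
  -- constant 1 is definitionally the series one, as the solver requires.
  constant : ℤ → PS
  constant c n m = scale c (δ n * δ m)
    where
    scale : ℤ → ℤ → ℤ
    scale (ℤ.+ 1) x = x
    scale c       x = c * x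

  constant-≈ : ∀ c → constant c ≈ (λ n m → c * (δ n * δ m))
  constant-≈ (ℤ.+ 0)             n m = refl
  constant-≈ (ℤ.+ 1)             n m = sym (*-identityˡ (δ n * δ m))
  constant-≈ (ℤ.+ suc (suc k))   n m = refl
  constant-≈ ℤ.-[1+ k ]          n m = refl

  private
    rearrange-ℤ : ∀ a b x y z → x * (y * (a * (b * z))) ≡ (a * (x * y)) * (b * z)
    rearrange-ℤ = solve-∀

  constant-* : ∀ a b → constant (a * b) ≈ constant a ⊛ constant b
  constant-* a b n m = begin
    constant (a * b) n m
      ≡⟨ constant-≈ (a * b) n m ⟩
    (a * b) * (δ n * δ m)
      ≡⟨ *-assoc a b _ ⟩
    a * (b * (δ n * δ m))
      ≡⟨ Σ-δ m (λ j → a * (b * (δ n * δ (m ∸ j)))) ⟨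
    Σ≤ m (λ j → δ j * (a * (b * (δ n * δ (m ∸ j)))))
      ≡⟨ Σ-δ n (λ i → Σ≤ m (λ j → δ j * (a * (b * (δ (n ∸ i) * δ (m ∸ j)))))) ⟨
    Σ≤ n (λ i → δ i * Σ≤ m (λ j → δ j * (a * (b * (δ (n ∸ i) * δ (m ∸ j))))))
      ≡⟨ Σ-cong′ n (λ i → trans (Σ-*ˡ m (δ i) _) (Σ-cong′ m (λ j → rearrange-ℤ a b (δ i) (δ j) _))) ⟩
    Σ≤ n (λ i → Σ≤ m (λ j → (a * (δ i * δ j)) * (b * (δ (n ∸ i) * δ (m ∸ j)))))
      ≡⟨ Σ-cong′ n (λ i → Σ-cong′ m (λ j → cong₂ _*_ (constant-≈ a i j) (constant-≈ b (n ∸ i) (m ∸ j)))) ⟨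
    (constant a ⊛ constant b) n m ∎

  ACR : AlmostCommutativeRing _ _
  ACR = fromCommutativeRing PS-commutativeRing

  constant-homomorphism :
    CommutativeRing.rawRing +-*-commutativeRing -Raw-AlmostCommutative⟶ ACR
  constant-homomorphism = record
    { ⟦_⟧    = constant
    ; +-homo = λ a b n m → begin
        constant (a + b) n m                               ≡⟨ constant-≈ (a + b) n m ⟩
        (a + b) * (δ n * δ m)                              ≡⟨ *-distribʳ-+ (δ n * δ m) a b ⟩
        a * (δ n * δ m) + b * (δ n * δ m)                  ≡⟨ cong₂ _+_ (constant-≈ a n m) (constant-≈ b n m) ⟨
        constant a n m + constant b n m                    ∎
    ; *-homo = constant-*
    ; -‿homo = λ a n m → begin
        constant (- a) n m                                 ≡⟨ constant-≈ (- a) n m ⟩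
        - a * (δ n * δ m)                                  ≡⟨ neg-distribˡ-* a (δ n * δ m) ⟨
        - (a * (δ n * δ m))                                ≡⟨ cong -_ (constant-≈ a n m) ⟨
        - constant a n m                                   ∎
    ; 0-homo = λ n m → *-zeroˡ (δ n * δ m)
    ; 1-homo = λ n m → refl
    }

  constant-≟ : ∀ a b → Maybe (constant a ≈ constant b)
  constant-≟ a b with a ≟ b
  ... | yes a≡b = just (λ n m → cong (λ c → constant c n m) a≡b)
  ... | no  _   = nothing

  open import Algebra.Solver.Ring (CommutativeRing.rawRing +-*-commutativeRing) ACR
    constant-homomorphism constant-≟ public


module Counting where

  open import Data.Nat using (ℕ; suc; _+_)
  open import Data.Nat.ListAction using (sum)
  open import Data.List using (List; []; _∷_; _++_; length; filter; map; concatMap)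
  open import Data.List.Properties using (filter-++; length-++; filter-none)
  open import Data.List.Membership.Propositional using (_∈_; find; lose)
  open import Data.List.Membership.Propositional.Properties using (∈-concatMap⁺; ∈-concatMap⁻)
  open import Data.List.Relation.Unary.Any using (here; there)
  import Data.List.Relation.Unary.All as All
  open import Data.List.Relation.Unary.Unique.Propositional using (Unique)
  open import Data.List.Relation.Unary.AllPairs using ([]; _∷_)
  import Data.List.Relation.Unary.Unique.Propositional.Properties as Unique
  open import Data.List.Relation.Binary.BagAndSetEquality using (_∼[_]_; set; ∼bag⇒↭)
  open import Data.List.Membership.Propositional.Properties.WithK using (unique∧set⇒bag)
  open import Data.List.Relation.Binary.Permutation.Propositional.Properties using (filter-↭; ↭-length)
  open import Data.Product using (_×_; _,_; ∃)
  open import Level using (0ℓ)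
  open import Relation.Nullary using (¬_; yes; no)
  open import Data.Empty using (⊥-elim)
  open import Relation.Unary using (Pred; Decidable)
  open import Relation.Binary.PropositionalEquality

  count : ∀ {A : Set} {P : Pred A 0ℓ} → Decidable P → List A → ℕ
  count P? xs = length (filter P? xs)

  module _ {A : Set} {P : Pred A 0ℓ} (P? : Decidable P) where

    count-++ : ∀ xs ys → count P? (xs ++ ys) ≡ count P? xs + count P? ys
    count-++ xs ys = trans (cong length (filter-++ P? xs ys)) (length-++ (filter P? xs))

    count-concatMap : ∀ {B : Set} (F : B → List A) bs →
                      count P? (concatMap F bs) ≡ sum (map (λ b → count P? (F b)) bs)
    count-concatMap F []       = refl
    count-concatMap F (b ∷ bs) =
      trans (count-++ (F b) (concatMap F bs)) (cong (count P? (F b) +_) (count-concatMap F bs))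

    count-map : ∀ {B : Set} (g : B → A) bs → count P? (map g bs) ≡ count (λ b → P? (g b)) bs
    count-map g []       = refl
    count-map g (b ∷ bs) with P? (g b)
    ... | yes _ = cong suc (count-map g bs)
    ... | no  _ = count-map g bs

    count-none : ∀ xs → (∀ {x} → x ∈ xs → ¬ P x) → count P? xs ≡ 0
    count-none xs none = cong length (filter-none P? (All.tabulate none))

    count-cong : ∀ {Q : Pred A 0ℓ} (Q? : Decidable Q) xs →
                 (∀ {x} → x ∈ xs → P x → Q x) → (∀ {x} → x ∈ xs → Q x → P x) →
                 count P? xs ≡ count Q? xs
    count-cong Q? []       P⇒Q Q⇒P = refl
    count-cong Q? (x ∷ xs) P⇒Q Q⇒P with P? x | Q? x
    ... | yes _ | yes _ = cong suc (count-cong Q? xs (λ m → P⇒Q (there m)) (λ m → Q⇒P (there m)))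
    ... | no  _ | no  _ = count-cong Q? xs (λ m → P⇒Q (there m)) (λ m → Q⇒P (there m))
    ... | yes p | no ¬q = ⊥-elim (¬q (P⇒Q (here refl) p))
    ... | no ¬p | yes q = ⊥-elim (¬p (Q⇒P (here refl) q))

    -- Two duplicate-free lists with the same elements are permutations of
    -- each other, so every count agrees on them.
    count-unique-set : ∀ {xs ys} → Unique xs → Unique ys → xs ∼[ set ] ys →
                       count P? xs ≡ count P? ys
    count-unique-set uxs uys xs≈ys = ↭-length (filter-↭ P? (∼bag⇒↭ (unique∧set⇒bag uxs uys xs≈ys)))

  ∈-concatMap-witness : ∀ {A B : Set} (F : B → List A) {bs z} →
                        z ∈ concatMap F bs → ∃ λ b → b ∈ bs × z ∈ F b
  ∈-concatMap-witness F z∈ = find (∈-concatMap⁻ F z∈)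

  ∈-concatMap-intro : ∀ {A B : Set} (F : B → List A) {bs b z} →
                      b ∈ bs → z ∈ F b → z ∈ concatMap F bs
  ∈-concatMap-intro F b∈ z∈ = ∈-concatMap⁺ F (lose b∈ z∈)

  unique-concatMap : ∀ {A B : Set} (F : B → List A) {bs} → Unique bs →
                     (∀ {b} → b ∈ bs → Unique (F b)) →
                     (∀ {b b′ z} → b ∈ bs → b′ ∈ bs → z ∈ F b → z ∈ F b′ → b ≡ b′) →
                     Unique (concatMap F bs)
  unique-concatMap F {[]}     _              _      _   = []
  unique-concatMap F {b ∷ bs} ub∷bs@(_ ∷ ubs) unique key =
    Unique.++⁺ (unique (here refl))
               (unique-concatMap F ubs (λ m → unique (there m)) (λ m m′ → key (there m) (there m′)))
               disjoint
    where
    disjoint : ∀ {z} → ¬ (z ∈ F b × z ∈ concatMap F bs)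
    disjoint (z∈Fb , z∈rest) with ∈-concatMap-witness F z∈rest
    ... | b′ , b′∈bs , z∈Fb′ with key (here refl) (there b′∈bs) z∈Fb z∈Fb′
    ... | refl = Unique.Unique[x∷xs]⇒x∉xs ub∷bs b′∈bs


-- The pattern 132 as an inductive predicate, equivalent to contains132.
module Pattern132 where

  open import Defs using (has21above; contains132)
  open import Data.Nat using (ℕ; _+_; _<_; _<ᵇ_)
  open import Data.Nat.Properties using (<ᵇ⇒<; <⇒<ᵇ; <-asym; <-trans; +-cancelˡ-<; +-monoʳ-<)
  open import Data.Bool using (Bool; true; false; T; _∧_)
  open import Data.Bool.Properties using (T-∨; T-∧)
  open import Data.List using (List; []; _∷_; _++_; map)
  open import Data.List.Properties using (++-assoc)
  open import Data.List.Membership.Propositional using (_∈_; lose; find)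
  open import Data.List.Membership.Propositional.Properties using (∈-∃++)
  open import Data.List.Relation.Unary.Any as Any using (Any; here; there)
  open import Data.List.Relation.Unary.Any.Properties using (any⁺; any⁻; ++⁺ˡ; ++⁻; map⁺; map⁻)
  open import Data.Product using (_×_; _,_; ∃₂)
  open import Data.Sum using (_⊎_; inj₁; inj₂)
  open import Data.Empty using (⊥-elim)
  open import Function.Bundles using (Equivalence)
  open import Relation.Nullary using (¬_)
  open import Relation.Binary.PropositionalEquality
  open Equivalence using (to; from)

  -- Above21 a bs: bs has an entry b followed later by an entry c with
  -- a < c < b, so that a ∷ bs has a 132 occurrence starting at its head.
  data Above21 (a : ℕ) : List ℕ → Set where
    here  : ∀ {b bs} → a < b → Any (λ c → a < c × c < b) bs → Above21 a (b ∷ bs)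
    there : ∀ {b bs} → Above21 a bs → Above21 a (b ∷ bs)

  data Has132 : List ℕ → Set where
    here  : ∀ {a as} → Above21 a as → Has132 (a ∷ as)
    there : ∀ {a as} → Has132 as → Has132 (a ∷ as)

  above21-sound : ∀ a bs → T (has21above a bs) → Above21 a bs
  above21-sound a (b ∷ bs) t with to T-∨ t
  ... | inj₂ rest = there (above21-sound a bs rest)
  ... | inj₁ t′ with to T-∧ t′
  ... | a<ᵇb , t″ = here (<ᵇ⇒< a b a<ᵇb) (Any.map between (any⁻ _ bs t″))
    where
    between : ∀ {c} → T ((a <ᵇ c) ∧ (c <ᵇ b)) → a < c × c < b
    between {c} t with to T-∧ t
    ... | p , q = <ᵇ⇒< a c p , <ᵇ⇒< c b q

  above21-complete : ∀ {a bs} → Above21 a bs → T (has21above a bs)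
  above21-complete {a} (here {b} a<b cs) =
    from T-∨ (inj₁ (from T-∧ (<⇒<ᵇ a<b , any⁺ _ (Any.map (λ (p , q) → from T-∧ (<⇒<ᵇ p , <⇒<ᵇ q)) cs))))
  above21-complete (there above) = from T-∨ (inj₂ (above21-complete above))

  has132-sound : ∀ σ → T (contains132 σ) → Has132 σ
  has132-sound (a ∷ as) t with to T-∨ t
  ... | inj₁ h = here (above21-sound a as h)
  ... | inj₂ h = there (has132-sound as h)

  has132-complete : ∀ {σ} → Has132 σ → T (contains132 σ)
  has132-complete (here above) = from T-∨ (inj₁ (above21-complete above))
  has132-complete (there h)    = from T-∨ (inj₂ (has132-complete h))

  avoids-sound : ∀ {σ} → contains132 σ ≡ false → ¬ Has132 σ
  avoids-sound eq h with has132-complete h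
  ... | t rewrite eq = t

  avoids-complete : ∀ σ → ¬ Has132 σ → contains132 σ ≡ false
  avoids-complete σ ¬h with contains132 σ in eq
  ... | false = refl
  ... | true  = ⊥-elim (¬h (has132-sound σ (subst T (sym eq) _)))

  above21-++ˡ : ∀ {a xs} zs → Above21 a xs → Above21 a (xs ++ zs)
  above21-++ˡ zs (here a<b cs) = here a<b (++⁺ˡ cs)
  above21-++ˡ zs (there above) = there (above21-++ˡ zs above)

  has132-++ˡ : ∀ {xs} zs → Has132 xs → Has132 (xs ++ zs)
  has132-++ˡ zs (here above) = here (above21-++ˡ zs above)
  has132-++ˡ zs (there h)    = there (has132-++ˡ zs h)

  has132-++ʳ : ∀ ws {zs} → Has132 zs → Has132 (ws ++ zs)
  has132-++ʳ []       h = h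
  has132-++ʳ (w ∷ ws) h = there (has132-++ʳ ws h)

  has132-around : ∀ xs M ys {x y} → x ∈ xs → y ∈ ys → x < y → y < M → Has132 (xs ++ M ∷ ys)
  has132-around xs M ys x∈xs y∈ys x<y y<M with ∈-∃++ x∈xs
  ... | ws , vs , refl =
    subst Has132 (sym (++-assoc ws (_ ∷ vs) (M ∷ ys)))
      (has132-++ʳ ws (here (above-after vs)))
    where
    above-after : ∀ us → Above21 _ (us ++ M ∷ ys)
    above-after []       = here (<-trans x<y y<M) (lose y∈ys (x<y , y<M))
    above-after (u ∷ us) = there (above-after us)

  no-above21 : ∀ {a bs} → (∀ {b} → b ∈ bs → b < a) → ¬ Above21 a bs
  no-above21 bs<a (here a<b _)  = <-asym a<b (bs<a (here refl))
  no-above21 bs<a (there above) = no-above21 (λ m → bs<a (there m)) above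

  above21-++⁻ : ∀ xs {a zs} → Above21 a (xs ++ zs) →
    Above21 a xs ⊎ Above21 a zs ⊎ ∃₂ (λ b c → b ∈ xs × c ∈ zs × a < c × c < b)
  above21-++⁻ []       above = inj₂ (inj₁ above)
  above21-++⁻ (b ∷ xs) (here a<b cs) with ++⁻ xs cs
  ... | inj₁ cs-xs = inj₁ (here a<b cs-xs)
  ... | inj₂ cs-zs with find cs-zs
  ... | c , c∈zs , a<c , c<b = inj₂ (inj₂ (b , c , here refl , c∈zs , a<c , c<b))
  above21-++⁻ (b ∷ xs) (there above) with above21-++⁻ xs above
  ... | inj₁ in-xs                             = inj₁ (there in-xs)
  ... | inj₂ (inj₁ in-zs)                     = inj₂ (inj₁ in-zs)
  ... | inj₂ (inj₂ (b′ , c , b′∈ , c∈ , lt))  = inj₂ (inj₂ (b′ , c , there b′∈ , c∈ , lt))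

  avoids-glue : ∀ xs M ys → ¬ Has132 xs → ¬ Has132 ys →
    (∀ {x} → x ∈ xs → x < M) → (∀ {y} → y ∈ ys → y < M) →
    (∀ {x y} → x ∈ xs → y ∈ ys → y < x) → ¬ Has132 (xs ++ M ∷ ys)
  avoids-glue [] M ys _ ¬ys _ ys<M _ (here above) = no-above21 ys<M above
  avoids-glue [] M ys _ ¬ys _ _    _ (there h)    = ¬ys h
  avoids-glue (x ∷ xs) M ys ¬xs ¬ys xs<M ys<M ys<xs (here above) with above21-++⁻ xs above
  ... | inj₁ in-xs = ¬xs (here in-xs)
  ... | inj₂ (inj₁ (here _ cs)) with find cs
  ...   | c , c∈ys , x<c , _ = <-asym x<c (ys<xs (here refl) c∈ys)
  avoids-glue (x ∷ xs) M ys ¬xs ¬ys xs<M ys<M ys<xs (here above)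
      | inj₂ (inj₁ (there in-ys)) = no-above21 (ys<xs (here refl)) in-ys
  avoids-glue (x ∷ xs) M ys ¬xs ¬ys xs<M ys<M ys<xs (here above)
      | inj₂ (inj₂ (b , .M , b∈xs , here refl , _ , M<b)) = <-asym M<b (xs<M (there b∈xs))
  avoids-glue (x ∷ xs) M ys ¬xs ¬ys xs<M ys<M ys<xs (here above)
      | inj₂ (inj₂ (b , c , b∈xs , there c∈ys , x<c , _)) = <-asym x<c (ys<xs (here refl) c∈ys)
  avoids-glue (x ∷ xs) M ys ¬xs ¬ys xs<M ys<M ys<xs (there h) =
    avoids-glue xs M ys (λ h′ → ¬xs (there h′)) ¬ys (λ m → xs<M (there m)) ys<M (λ m → ys<xs (there m)) h

  shift : ℕ → List ℕ → List ℕ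
  shift d = map (d +_)

  above21-shift⁺ : ∀ d {a bs} → Above21 a bs → Above21 (d + a) (shift d bs)
  above21-shift⁺ d (here a<b cs) =
    here (+-monoʳ-< d a<b) (map⁺ (Any.map (λ (p , q) → +-monoʳ-< d p , +-monoʳ-< d q) cs))
  above21-shift⁺ d (there above) = there (above21-shift⁺ d above)

  above21-shift⁻ : ∀ d {a} bs → Above21 (d + a) (shift d bs) → Above21 a bs
  above21-shift⁻ d {a} (b ∷ bs) (here a<b cs) =
    here (+-cancelˡ-< d a b a<b)
         (Any.map (λ {c} (p , q) → +-cancelˡ-< d a c p , +-cancelˡ-< d c b q) (map⁻ cs))
  above21-shift⁻ d (b ∷ bs) (there above) = there (above21-shift⁻ d bs above)

  has132-shift⁺ : ∀ d {σ} → Has132 σ → Has132 (shift d σ)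
  has132-shift⁺ d (here above) = here (above21-shift⁺ d above)
  has132-shift⁺ d (there h)    = there (has132-shift⁺ d h)

  has132-shift⁻ : ∀ d σ → Has132 (shift d σ) → Has132 σ
  has132-shift⁻ d (a ∷ as) (here above) = here (above21-shift⁻ d as above)
  has132-shift⁻ d (a ∷ as) (there h)    = there (has132-shift⁻ d as h)


-- 132-avoiding arrangements of intervals of ℕ, and the list S132 n.
module Arrangements where

  open import Defs using (words; distinct; S132; contains132)
  open Pattern132
  open Counting using (unique-concatMap; ∈-concatMap-witness; ∈-concatMap-intro)
  open import Data.Nat using (ℕ; zero; suc; _+_; _∸_; _≤_; _<_; z≤n; s≤s; _≡ᵇ_)
  open import Data.Nat.Properties
  open import Data.Bool using (Bool; true; false; T; not)
  open import Data.Bool.Properties using (T-∧; T-≡) renaming (_≟_ to _≟B_)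
  open import Data.Bool.ListAction using (any)
  open import Data.List using (List; []; _∷_; _++_; length; map; upTo)
  open import Data.List.Properties using (length-map; length-++-sucʳ; ∷-injectiveʳ)
  open import Data.List.Membership.Propositional using (_∈_; _∉_; lose; find)
  open import Data.List.Membership.Propositional.Properties
    using (∈-++⁺ˡ; ∈-++⁺ʳ; ∈-++⁻; ∈-∃++; ∈-map⁺; ∈-map⁻; ∈-upTo⁺; ∈-upTo⁻; ∈-filter⁺; ∈-filter⁻)
  open import Data.List.Membership.DecPropositional _≟_ using (_∈?_)
  open import Data.List.Relation.Unary.Any using (Any; here; there)
  open import Data.List.Relation.Unary.Any.Properties using (any⁺; any⁻)
  open import Data.List.Relation.Unary.All as All using (All; []; _∷_)
  import Data.List.Relation.Unary.All.Properties as All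
  open import Data.List.Relation.Unary.Unique.Propositional using (Unique)
  open import Data.List.Relation.Unary.AllPairs using ([]; _∷_)
  import Data.List.Relation.Unary.Unique.Propositional.Properties as Unique
  open import Data.Product using (_×_; _,_; proj₁; proj₂; ∃)
  open import Data.Sum using (inj₁; inj₂)
  open import Data.Empty using (⊥-elim)
  open import Function.Bundles using (Equivalence)
  open import Relation.Nullary using (¬_; yes; no)
  open import Relation.Binary.PropositionalEquality
  open Equivalence using (to; from)

  T-not⇒¬T : ∀ {x} → T (not x) → ¬ T x
  T-not⇒¬T {false} _ ()

  ¬T⇒T-not : ∀ {x} → ¬ T x → T (not x)
  ¬T⇒T-not {false} _  = _
  ¬T⇒T-not {true}  ¬t = ¬t _

  record Avoider (lo n : ℕ) (σ : List ℕ) : Set where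
    field
      length≡ : length σ ≡ n
      unique  : Unique σ
      range   : ∀ {a} → a ∈ σ → lo < a × a ≤ lo + n
      avoids  : ¬ Has132 σ
  open Avoider public

  distinct⇒unique : ∀ σ → T (distinct σ) → Unique σ
  distinct⇒unique []       _ = []
  distinct⇒unique (a ∷ as) t = All.tabulate a≢ ∷ distinct⇒unique as (proj₂ (to T-∧ t))
    where
    a≢ : ∀ {b} → b ∈ as → a ≢ b
    a≢ b∈as refl = T-not⇒¬T (proj₁ (to T-∧ t)) (any⁺ _ (lose b∈as (≡⇒≡ᵇ a a refl)))

  unique⇒distinct : ∀ {σ} → Unique σ → T (distinct σ)
  unique⇒distinct []                 = _
  unique⇒distinct {a ∷ as} (a≢ ∷ u) = from T-∧ (¬T⇒T-not no-repeat , unique⇒distinct u)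
    where
    no-repeat : ¬ T (any (λ b → a ≡ᵇ b) as)
    no-repeat t with find (any⁻ _ as t)
    ... | b , b∈as , a≡ᵇb = All.lookup a≢ b∈as (≡ᵇ⇒≡ a b a≡ᵇb)

  letters : ℕ → List ℕ
  letters n = map suc (upTo n)

  ∈-letters⁻ : ∀ {n a} → a ∈ letters n → 0 < a × a ≤ n
  ∈-letters⁻ a∈ with ∈-map⁻ suc a∈
  ... | i , i∈ , refl = s≤s z≤n , ∈-upTo⁻ i∈

  ∈-letters⁺ : ∀ {n a} → 0 < a → a ≤ n → a ∈ letters n
  ∈-letters⁺ {a = suc i} _ a≤n = ∈-map⁺ suc (∈-upTo⁺ a≤n)

  ∈-words⁻ : ∀ n k {σ} → σ ∈ words n k → length σ ≡ k × (∀ {a} → a ∈ σ → 0 < a × a ≤ n)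
  ∈-words⁻ n zero    (here refl) = refl , λ ()
  ∈-words⁻ n (suc k) σ∈ with ∈-concatMap-witness (λ a → map (a ∷_) (words n k)) {letters n} σ∈
  ... | a , a∈ , σ∈′ with ∈-map⁻ (a ∷_) σ∈′
  ... | τ , τ∈ , refl with ∈-words⁻ n k τ∈
  ... | len , rng = cong suc len , λ { (here refl) → ∈-letters⁻ a∈ ; (there b∈) → rng b∈ }

  ∈-words⁺ : ∀ n k σ → length σ ≡ k → (∀ {a} → a ∈ σ → 0 < a × a ≤ n) → σ ∈ words n k
  ∈-words⁺ n zero    []      refl rng = here refl
  ∈-words⁺ n (suc k) (a ∷ σ) refl rng =
    ∈-concatMap-intro (λ a → map (a ∷_) (words n k))
      (∈-letters⁺ (proj₁ (rng (here refl))) (proj₂ (rng (here refl))))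
      (∈-map⁺ (a ∷_) (∈-words⁺ n k σ refl (λ b∈ → rng (there b∈))))

  unique-words : ∀ n k → Unique (words n k)
  unique-words n zero    = [] ∷ []
  unique-words n (suc k) =
    unique-concatMap (λ a → map (a ∷_) (words n k))
      (Unique.map⁺ suc-injective (Unique.upTo⁺ n))
      (λ _ → Unique.map⁺ ∷-injectiveʳ (unique-words n k))
      same-head
    where
    same-head : ∀ {a b σ} → a ∈ letters n → b ∈ letters n →
                σ ∈ map (a ∷_) (words n k) → σ ∈ map (b ∷_) (words n k) → a ≡ b
    same-head _ _ σ∈a σ∈b with ∈-map⁻ _ σ∈a | ∈-map⁻ _ σ∈b
    ... | _ , _ , refl | _ , _ , refl = refl

  unique-S132 : ∀ n → Unique (S132 n)
  unique-S132 n = Unique.filter⁺ _ (Unique.filter⁺ _ (unique-words n n))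

  ∈-S132⁻ : ∀ n {σ} → σ ∈ S132 n → Avoider 0 n σ
  ∈-S132⁻ n σ∈ with ∈-filter⁻ (λ σ → contains132 σ ≟B false) σ∈
  ... | σ∈S , no132 with ∈-filter⁻ (λ σ → distinct σ ≟B true) σ∈S
  ... | σ∈words , dist with ∈-words⁻ n n σ∈words
  ... | len , rng = record
    { length≡ = len
    ; unique  = distinct⇒unique _ (from T-≡ dist)
    ; range   = rng
    ; avoids  = avoids-sound no132
    }

  ∈-S132⁺ : ∀ n {σ} → Avoider 0 n σ → σ ∈ S132 n
  ∈-S132⁺ n {σ} av =
    ∈-filter⁺ (λ σ → contains132 σ ≟B false)
      (∈-filter⁺ (λ σ → distinct σ ≟B true)
        (∈-words⁺ n n σ (length≡ av) (range av))
        (to T-≡ (unique⇒distinct (unique av))))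
      (avoids-complete σ (avoids av))

  unique-delete : ∀ {A : Set} as {x : A} {bs} → Unique (as ++ x ∷ bs) → Unique (as ++ bs) × x ∉ as ++ bs
  unique-delete []       (x∉bs ∷ u) = u , λ x∈bs → All.lookup x∉bs x∈bs refl
  unique-delete (a ∷ as) {x} {bs} (a≢ ∷ u) with unique-delete as u
  ... | u′ , x∉ = (All.++⁺ (All.++⁻ˡ as a≢) (All.++⁻ʳ (x ∷ []) (All.++⁻ʳ as a≢)) ∷ u′) , x∉a∷
    where
    x∉a∷ : x ∉ a ∷ as ++ bs
    x∉a∷ (here refl) = All.lookup a≢ (∈-++⁺ʳ as (here refl)) refl
    x∉a∷ (there x∈) = x∉ x∈

  lower-bound : ∀ {a lo k} → a ≤ lo + suc k → a ≢ lo + suc k → a ≤ lo + k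
  lower-bound {a} {lo} {k} a≤ a≢ = ≤-pred (subst (a <_) (+-suc lo k) (≤∧≢⇒< a≤ a≢))

  -- A duplicate-free list of values in (lo, lo + k] has at most k entries:
  -- by induction on k, deleting the value lo + k if it occurs.
  length-bound : ∀ k lo zs → Unique zs → (∀ {a} → a ∈ zs → lo < a × a ≤ lo + k) → length zs ≤ k
  length-bound zero lo []       _ _   = z≤n
  length-bound zero lo (z ∷ zs) _ rng with rng (here refl)
  ... | lo<z , z≤lo = ⊥-elim (<⇒≱ lo<z (subst (z ≤_) (+-identityʳ lo) z≤lo))
  length-bound (suc k) lo zs u rng with (lo + suc k) ∈? zs
  ... | no top∉ = m≤n⇒m≤1+n (length-bound k lo zs u rng′)
    where
    rng′ : ∀ {a} → a ∈ zs → lo < a × a ≤ lo + k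
    rng′ a∈ = proj₁ (rng a∈) , lower-bound (proj₂ (rng a∈)) (λ { refl → top∉ a∈ })
  ... | yes top∈ with ∈-∃++ top∈
  ... | as , bs , refl with unique-delete as u
  ... | u′ , top∉ = subst (_≤ suc k) (sym (length-++-sucʳ as _ bs)) (s≤s (length-bound k lo (as ++ bs) u′ rng′))
    where
    keep : ∀ {a} → a ∈ as ++ bs → a ∈ as ++ lo + suc k ∷ bs
    keep a∈ with ∈-++⁻ as a∈
    ... | inj₁ a∈as = ∈-++⁺ˡ a∈as
    ... | inj₂ a∈bs = ∈-++⁺ʳ as (there a∈bs)
    rng′ : ∀ {a} → a ∈ as ++ bs → lo < a × a ≤ lo + k
    rng′ a∈ = proj₁ (rng (keep a∈)) , lower-bound (proj₂ (rng (keep a∈))) (λ { refl → top∉ a∈ })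

  top∈ : ∀ {lo n σ} → Avoider lo (suc n) σ → lo + suc n ∈ σ
  top∈ {lo} {n} {σ} av with (lo + suc n) ∈? σ
  ... | yes top∈σ = top∈σ
  ... | no  top∉σ = ⊥-elim (<-irrefl (length≡ av) (s≤s (length-bound n lo σ (unique av) rng′)))
    where
    rng′ : ∀ {a} → a ∈ σ → lo < a × a ≤ lo + n
    rng′ a∈ = proj₁ (range av a∈) , lower-bound (proj₂ (range av a∈)) (λ { refl → top∉σ a∈ })

  avoider-shift : ∀ d {lo n σ} → Avoider lo n σ → Avoider (d + lo) n (shift d σ)
  avoider-shift d {lo} {n} {σ} av = record
    { length≡ = trans (length-map (d +_) σ) (length≡ av)
    ; unique  = Unique.map⁺ (+-cancelˡ-≡ d _ _) (unique av)
    ; range   = rng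
    ; avoids  = λ h → avoids av (has132-shift⁻ d σ h)
    }
    where
    rng : ∀ {b} → b ∈ shift d σ → d + lo < b × b ≤ d + lo + n
    rng b∈ with ∈-map⁻ (d +_) b∈
    ... | a , a∈ , refl with range av a∈
    ... | lo<a , a≤ = +-monoʳ-< d lo<a , subst (d + a ≤_) (sym (+-assoc d lo n)) (+-monoʳ-≤ d a≤)

  shift-unshift : ∀ d σ → (∀ {a} → a ∈ σ → d ≤ a) → shift d (map (_∸ d) σ) ≡ σ
  shift-unshift d []      _   = refl
  shift-unshift d (a ∷ σ) d≤ = cong₂ _∷_ (m+[n∸m]≡n (d≤ (here refl))) (shift-unshift d σ (λ b∈ → d≤ (there b∈)))

  avoider-unshift : ∀ {d n σ} → Avoider d n σ → ∃ λ τ → σ ≡ shift d τ × Avoider 0 n τ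
  avoider-unshift {d} {n} {σ} av = τ , sym σ≡ , record
    { length≡ = trans (length-map (_∸ d) σ) (length≡ av)
    ; unique  = Unique.map⁻ (subst Unique (sym σ≡) (unique av))
    ; range   = rng
    ; avoids  = λ h → avoids av (subst Has132 σ≡ (has132-shift⁺ d h))
    }
    where
    τ = map (_∸ d) σ
    σ≡ : shift d τ ≡ σ
    σ≡ = shift-unshift d σ (λ a∈ → <⇒≤ (proj₁ (range av a∈)))
    rng : ∀ {b} → b ∈ τ → 0 < b × b ≤ n
    rng b∈ with ∈-map⁻ (_∸ d) b∈
    ... | a , a∈ , refl with range av a∈
    ... | d<a , a≤ = m<n⇒0<n∸m d<a , m≤n+o⇒m∸n≤o _ d a≤


-- Decomposing a 132-avoider at its maximum: S132 (suc n) is enumerated,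
-- without repetition, by the list decompositions n.
module Decomposition where

  open import Defs using (S132)
  open Pattern132
  open Arrangements
  open Counting using (unique-concatMap; ∈-concatMap-witness; ∈-concatMap-intro)
  open import Data.Nat using (ℕ; suc; _+_; _∸_; _≤_; _<_; z≤n; s≤s; _<?_)
  open import Data.Nat.Properties
  open import Data.List using (List; []; _∷_; _++_; length; map; upTo; concatMap)
  open import Data.List.Properties using (length-++; length-map; ++-cancelˡ; ∷-injective; map-injective)
  open import Data.List.Membership.Propositional using (_∈_; _∉_)
  open import Data.List.Membership.Propositional.Properties
    using (∈-++⁺ˡ; ∈-++⁺ʳ; ∈-++⁻; ∈-∃++; ∈-map⁺; ∈-map⁻; ∈-upTo⁺; ∈-upTo⁻)
  open import Data.List.Relation.Unary.Any using (here; there)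
  import Data.List.Relation.Unary.All as All
  import Data.List.Relation.Unary.All.Properties as All
  open import Data.List.Relation.Unary.Unique.Propositional using (Unique)
  open import Data.List.Relation.Unary.AllPairs using ([]; _∷_)
  import Data.List.Relation.Unary.Unique.Propositional.Properties as Unique
  open import Data.Product using (_×_; _,_; proj₁; proj₂; ∃₂)
  open import Data.Sum using (inj₁; inj₂)
  open import Data.Empty using (⊥-elim)
  open import Relation.Nullary using (yes; no)
  open import Relation.Binary.Definitions using (tri<; tri≈; tri>)
  open import Relation.Binary.PropositionalEquality

  insertMax : ℕ → ℕ → List ℕ → List ℕ → List ℕ
  insertMax n j xs ys = shift j xs ++ suc n ∷ ys

  -- The candidates with i entries before the maximum.
  block : ℕ → ℕ → List (List ℕ)
  block n i = concatMap (λ xs → map (insertMax n (n ∸ i) xs) (S132 (n ∸ i))) (S132 i)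

  decompositions : ℕ → List (List ℕ)
  decompositions n = concatMap (block n) (upTo (suc n))

  unique-++⁻ : ∀ {A : Set} (xs : List A) {ys} → Unique (xs ++ ys) →
               Unique xs × Unique ys × (∀ {z} → z ∈ xs → z ∉ ys)
  unique-++⁻ []       u          = [] , u , λ ()
  unique-++⁻ (x ∷ xs) (x≢ ∷ u) with unique-++⁻ xs u
  ... | uxs , uys , disjoint = All.++⁻ˡ xs x≢ ∷ uxs , uys , x∉
    where
    x∉ : ∀ {z} → z ∈ x ∷ xs → z ∉ _
    x∉ (here refl) z∈ys = All.lookup (All.++⁻ʳ xs x≢) z∈ys refl
    x∉ (there z∈xs)     = disjoint z∈xs

  avoider-insertMax : ∀ {n i j xs ys} → i + j ≡ n → Avoider 0 i xs → Avoider 0 j ys →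
                      Avoider 0 (suc n) (insertMax n j xs ys)
  avoider-insertMax {n} {i} {j} {xs} {ys} i+j≡n avx avy = record
    { length≡ = trans (length-++ (shift j xs)) (trans (cong₂ (λ a b → a + suc b) (length≡ avx′) (length≡ avy))
                  (trans (+-suc i j) (cong suc i+j≡n)))
    ; unique  = Unique.++⁺ (unique avx′) (All.tabulate (λ y∈ M≡y → <-irrefl (sym M≡y) (s≤s (ys≤n y∈))) ∷ unique avy)
                  (λ { (x∈ , here refl) → <-irrefl refl (s≤s (xs≤n x∈))
                     ; (x∈ , there y∈)  → <-irrefl refl (ys<xs x∈ y∈) })
    ; range   = rng
    ; avoids  = avoids-glue (shift j xs) (suc n) ys (avoids avx′) (avoids avy)
                  (λ x∈ → s≤s (xs≤n x∈)) (λ y∈ → s≤s (ys≤n y∈)) ys<xs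
    }
    where
    avx′ = avoider-shift j avx
    top≡ : j + 0 + i ≡ n
    top≡ = trans (cong (_+ i) (+-identityʳ j)) (trans (+-comm j i) i+j≡n)
    xs≤n : ∀ {x} → x ∈ shift j xs → x ≤ n
    xs≤n x∈ = subst (_ ≤_) top≡ (proj₂ (range avx′ x∈))
    ys≤n : ∀ {y} → y ∈ ys → y ≤ n
    ys≤n y∈ = ≤-trans (proj₂ (range avy y∈)) (subst (j ≤_) i+j≡n (m≤n+m j i))
    ys<xs : ∀ {x y} → x ∈ shift j xs → y ∈ ys → y < x
    ys<xs x∈ y∈ = ≤-<-trans (proj₂ (range avy y∈)) (subst (_< _) (+-identityʳ j) (proj₁ (range avx′ x∈)))
    rng : ∀ {a} → a ∈ insertMax n j xs ys → 0 < a × a ≤ suc n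
    rng a∈ with ∈-++⁻ (shift j xs) a∈
    ... | inj₁ x∈         = ≤-<-trans z≤n (proj₁ (range avx′ x∈)) , m≤n⇒m≤1+n (xs≤n x∈)
    ... | inj₂ (here refl) = s≤s z≤n , ≤-refl
    ... | inj₂ (there y∈)  = proj₁ (range avy y∈) , m≤n⇒m≤1+n (ys≤n y∈)

  -- Splitting: a 132-avoiding arrangement of (0, suc n] with the maximum in
  -- the middle has every entry before the maximum above every entry after
  -- it, so the two parts arrange (length ys, n] and (0, length ys].

  record Split (n : ℕ) (xs ys : List ℕ) : Set where
    field
      before : Avoider (length ys) (length xs) xs
      after  : Avoider 0 (length ys) ys
      sizes  : length xs + length ys ≡ n

  module SplitAtMax {n : ℕ} (xs ys : List ℕ) (av : Avoider 0 (suc n) (xs ++ suc n ∷ ys)) where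

    private
      i = length xs
      j = length ys
      M = suc n
      parts = unique-++⁻ xs (unique av)
      uM∷ys = proj₁ (proj₂ parts)

    unique-before : Unique xs
    unique-before = proj₁ parts

    unique-after : Unique ys
    unique-after with uM∷ys
    ... | _ ∷ u = u

    before∉after : ∀ {z} → z ∈ xs → z ∉ M ∷ ys
    before∉after = proj₂ (proj₂ parts)

    M∉after : M ∉ ys
    M∉after y∈ with uM∷ys
    ... | M≢ ∷ _ = All.lookup M≢ y∈ refl

    sizes : i + j ≡ n
    sizes = suc-injective (trans (sym (+-suc i j)) (trans (sym (length-++ xs)) (length≡ av)))

    n≡j+i : n ≡ j + i
    n≡j+i = trans (sym sizes) (+-comm i j)

    positive : ∀ {z} → z ∈ xs ++ M ∷ ys → 0 < z
    positive z∈ = proj₁ (range av z∈)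

    below-max : ∀ {z} → z ∈ xs ++ M ∷ ys → z ≢ M → z ≤ n
    below-max z∈ z≢M = lower-bound {lo = 0} (proj₂ (range av z∈)) z≢M

    before≤n : ∀ {x} → x ∈ xs → x ≤ n
    before≤n x∈ = below-max (∈-++⁺ˡ x∈) (λ { refl → before∉after x∈ (here refl) })

    after≤n : ∀ {y} → y ∈ ys → y ≤ n
    after≤n y∈ = below-max (∈-++⁺ʳ xs (there y∈)) (λ { refl → M∉after y∈ })

    -- x before M and y after M with x < y < M would form a 132.
    after<before : ∀ {x y} → x ∈ xs → y ∈ ys → y < x
    after<before {x} {y} x∈ y∈ with <-cmp y x
    ... | tri< y<x _ _  = y<x
    ... | tri≈ _ refl _ = ⊥-elim (before∉after x∈ (there y∈))
    ... | tri> _ _ x<y  = ⊥-elim (avoids av (has132-around xs M ys x∈ y∈ x<y (s≤s (after≤n y∈))))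

    -- An entry x ≤ j before M would give j + 1 distinct values in (0, j].
    j<before : ∀ {x} → x ∈ xs → j < x
    j<before {x} x∈ with j <? x
    ... | yes j<x = j<x
    ... | no  j≮x = ⊥-elim (<-irrefl refl (length-bound j 0 (x ∷ ys) u rng))
      where
      u : Unique (x ∷ ys)
      u = All.tabulate (λ y∈ x≡y → before∉after x∈ (there (subst (_∈ ys) (sym x≡y) y∈))) ∷ unique-after
      rng : ∀ {a} → a ∈ x ∷ ys → 0 < a × a ≤ j
      rng (here refl) = positive (∈-++⁺ˡ x∈) , ≮⇒≥ j≮x
      rng (there y∈)  = positive (∈-++⁺ʳ xs (there y∈)) , <⇒≤ (<-≤-trans (after<before x∈ y∈) (≮⇒≥ j≮x))

    -- An entry y > j after M would give i + 1 distinct values in (j, j + i].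
    after≤j : ∀ {y} → y ∈ ys → y ≤ j
    after≤j {y} y∈ with j <? y
    ... | no  j≮y = ≮⇒≥ j≮y
    ... | yes j<y = ⊥-elim (<-irrefl refl (length-bound i j (y ∷ xs) u rng))
      where
      u : Unique (y ∷ xs)
      u = All.tabulate (λ x∈ y≡x → before∉after x∈ (there (subst (_∈ ys) y≡x y∈))) ∷ unique-before
      rng : ∀ {a} → a ∈ y ∷ xs → j < a × a ≤ j + i
      rng (here refl) = j<y , subst (y ≤_) n≡j+i (after≤n y∈)
      rng (there x∈)  = <-trans j<y (after<before x∈ y∈) , subst (_ ≤_) n≡j+i (before≤n x∈)

  avoider-split : ∀ {n} xs ys → Avoider 0 (suc n) (xs ++ suc n ∷ ys) → Split n xs ys
  avoider-split xs ys av = record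
    { before = record
        { length≡ = refl
        ; unique  = unique-before
        ; range   = λ x∈ → j<before x∈ , subst (_ ≤_) n≡j+i (before≤n x∈)
        ; avoids  = λ h → avoids av (has132-++ˡ _ h) }
    ; after  = record
        { length≡ = refl
        ; unique  = unique-after
        ; range   = λ y∈ → positive (∈-++⁺ʳ xs (there y∈)) , after≤j y∈
        ; avoids  = λ h → avoids av (has132-++ʳ xs (there h)) }
    ; sizes  = sizes
    }
    where open SplitAtMax xs ys av

  ∈-block⁻ : ∀ {n i σ} → σ ∈ block n i →
             ∃₂ λ xs ys → xs ∈ S132 i × ys ∈ S132 (n ∸ i) × σ ≡ insertMax n (n ∸ i) xs ys
  ∈-block⁻ {n} {i} σ∈ with ∈-concatMap-witness (λ xs → map (insertMax n (n ∸ i) xs) (S132 (n ∸ i))) {S132 i} σ∈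
  ... | xs , xs∈ , σ∈′ with ∈-map⁻ _ σ∈′
  ... | ys , ys∈ , σ≡ = xs , ys , xs∈ , ys∈ , σ≡

  ∈-decompositions⁻ : ∀ n {σ} → σ ∈ decompositions n → σ ∈ S132 (suc n)
  ∈-decompositions⁻ n σ∈ with ∈-concatMap-witness (block n) {upTo (suc n)} σ∈
  ... | i , i∈ , σ∈block with ∈-block⁻ {n} {i} σ∈block
  ... | xs , ys , xs∈ , ys∈ , refl =
    ∈-S132⁺ (suc n) (avoider-insertMax (m+[n∸m]≡n (≤-pred (∈-upTo⁻ i∈))) (∈-S132⁻ i xs∈) (∈-S132⁻ (n ∸ i) ys∈))

  ∈-decompositions⁺ : ∀ n {σ} → σ ∈ S132 (suc n) → σ ∈ decompositions n
  ∈-decompositions⁺ n σ∈ with ∈-∃++ (top∈ (∈-S132⁻ (suc n) σ∈))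
  ... | xs , ys , refl with avoider-split xs ys (∈-S132⁻ (suc n) σ∈)
  ... | split with avoider-unshift (Split.before split)
  ... | τ , refl , avτ =
    ∈-concatMap-intro (block n) (∈-upTo⁺ (s≤s i≤n))
      (subst (λ j → shift (length ys) τ ++ suc n ∷ ys ∈ concatMap (λ xs → map (insertMax n j xs) (S132 j)) (S132 i))
        j≡n∸i
        (∈-concatMap-intro _ (∈-S132⁺ i avτ) (∈-map⁺ _ (∈-S132⁺ (length ys) (Split.after split)))))
    where
    i = length (shift (length ys) τ)
    i≤n : i ≤ n
    i≤n = subst (i ≤_) (Split.sizes split) (m≤m+n i (length ys))
    j≡n∸i : length ys ≡ n ∸ i
    j≡n∸i = trans (sym (m+n∸m≡n i (length ys))) (cong (_∸ i) (Split.sizes split))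

  -- The maximum occurs only once, so its position determines the split.
  split-at-max : ∀ {M : ℕ} xs xs′ {ys ys′} → M ∉ xs → M ∉ xs′ → xs ++ M ∷ ys ≡ xs′ ++ M ∷ ys′ → xs ≡ xs′
  split-at-max []       []         _   _    _  = refl
  split-at-max []       (x′ ∷ xs′) _   M∉′ eq = ⊥-elim (M∉′ (here (proj₁ (∷-injective eq))))
  split-at-max (x ∷ xs) []         M∉  _   eq = ⊥-elim (M∉ (here (sym (proj₁ (∷-injective eq)))))
  split-at-max (x ∷ xs) (x′ ∷ xs′) M∉  M∉′ eq =
    cong₂ _∷_ (proj₁ (∷-injective eq))
              (split-at-max xs xs′ (λ m → M∉ (there m)) (λ m → M∉′ (there m)) (proj₂ (∷-injective eq)))

  max∉ : ∀ {n i xs} → i ≤ n → xs ∈ S132 i → suc n ∉ shift (n ∸ i) xs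
  max∉ {n} {i} i≤n xs∈ M∈ with ∈-map⁻ _ M∈
  ... | a , a∈ , M≡ = <-irrefl (sym M≡) (s≤s (subst (n ∸ i + a ≤_) (m∸n+n≡m i≤n)
                                        (+-monoʳ-≤ (n ∸ i) (proj₂ (range (∈-S132⁻ i xs∈) a∈)))))

  prefix-of-insertMax : ∀ {n i i′ xs xs′ ys ys′} → i ≤ n → i′ ≤ n → xs ∈ S132 i → xs′ ∈ S132 i′ →
    insertMax n (n ∸ i) xs ys ≡ insertMax n (n ∸ i′) xs′ ys′ → shift (n ∸ i) xs ≡ shift (n ∸ i′) xs′
  prefix-of-insertMax i≤n i′≤n xs∈ xs′∈ = split-at-max _ _ (max∉ i≤n xs∈) (max∉ i′≤n xs′∈)

  -- Within a block, the prefix and then the suffix are determined.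
  unique-block : ∀ n i → i ≤ n → Unique (block n i)
  unique-block n i i≤n =
    unique-concatMap _ (unique-S132 i)
      (λ {xs} _ → Unique.map⁺ (λ eq → proj₂ (∷-injective (++-cancelˡ (shift (n ∸ i) xs) _ _ eq))) (unique-S132 (n ∸ i)))
      same-prefix
    where
    same-prefix : ∀ {xs xs′ σ} → xs ∈ S132 i → xs′ ∈ S132 i →
      σ ∈ map (insertMax n (n ∸ i) xs) (S132 (n ∸ i)) → σ ∈ map (insertMax n (n ∸ i) xs′) (S132 (n ∸ i)) → xs ≡ xs′
    same-prefix xs∈ xs′∈ σ∈ σ∈′ with ∈-map⁻ _ σ∈ | ∈-map⁻ _ σ∈′
    ... | _ , _ , refl | _ , _ , eq =
      map-injective (+-cancelˡ-≡ (n ∸ i) _ _) (prefix-of-insertMax i≤n i≤n xs∈ xs′∈ eq)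

  -- Across blocks, the length of the prefix is determined.
  unique-decompositions : ∀ n → Unique (decompositions n)
  unique-decompositions n =
    unique-concatMap (block n) (Unique.upTo⁺ (suc n)) (λ i∈ → unique-block n _ (≤-pred (∈-upTo⁻ i∈))) same-i
    where
    size : ∀ {i xs} d → xs ∈ S132 i → length (shift d xs) ≡ i
    size {xs = xs} d xs∈ = trans (length-map (d +_) xs) (length≡ (∈-S132⁻ _ xs∈))
    same-i : ∀ {i i′ σ} → i ∈ upTo (suc n) → i′ ∈ upTo (suc n) → σ ∈ block n i → σ ∈ block n i′ → i ≡ i′
    same-i {i} {i′} i∈ i′∈ σ∈ σ∈′ with ∈-block⁻ {n} {i} σ∈ | ∈-block⁻ {n} {i′} σ∈′
    ... | _ , _ , xs∈ , _ , refl | _ , _ , xs′∈ , _ , eq =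
      trans (sym (size _ xs∈))
        (trans (cong length (prefix-of-insertMax (≤-pred (∈-upTo⁻ i∈)) (≤-pred (∈-upTo⁻ i′∈)) xs∈ xs′∈ eq))
               (size _ xs′∈))


-- How mmp k behaves under translation and under the decomposition at the
-- maximum.
module MmpSplit where

  open import Defs using (mmpGo; mmp)
  open Pattern132 using (shift)
  open Counting
  open import Data.Nat using (ℕ; zero; suc; _+_; _<_; _<ᵇ_; _≤ᵇ_; _<?_; pred)
  open import Data.Nat.Properties using (<-asym; +-assoc; +-comm; +-cancelˡ-<; +-monoʳ-<; <⇒<ᵇ; <ᵇ⇒<)
  open import Data.Bool.Properties using (∨-assoc; T-≡)
  open import Function.Bundles using (Equivalence)
  open import Data.Empty using (⊥-elim)
  open import Data.Bool using (true; false; T; _∧_; _∨_; not; if_then_else_)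
  open import Data.Bool.ListAction using (any)
  open import Data.List using (List; []; _∷_; _++_; [_])
  open import Data.List.Properties using (++-assoc; ++-identityʳ; map-++)
  open import Data.List.Membership.Propositional using (_∈_)
  open import Data.List.Membership.Propositional.Properties using (∈-++⁻)
  open import Data.List.Relation.Unary.Any using (here; there)
  open import Data.Sum using (inj₁; inj₂)
  open import Relation.Binary.PropositionalEquality hiding ([_])

  <ᵇ-true : ∀ {a b} → a < b → (a <ᵇ b) ≡ true
  <ᵇ-true a<b = Equivalence.to T-≡ (<⇒<ᵇ a<b)

  <ᵇ-false : ∀ {a b} → b < a → (a <ᵇ b) ≡ false
  <ᵇ-false {a} {b} b<a with a <ᵇ b in eq
  ... | false = refl
  ... | true  = ⊥-elim (<-asym b<a (<ᵇ⇒< a b (subst T (sym eq) _)))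

  counted : ℕ → List ℕ → ℕ → List ℕ → ℕ
  counted k before a after =
    if (k ≤ᵇ count (a <?_) after) ∧ not (any (_<ᵇ a) before) then 1 else 0

  <ᵇ-shift : ∀ d c a → ((d + c) <ᵇ (d + a)) ≡ (c <ᵇ a)
  <ᵇ-shift zero    c a = refl
  <ᵇ-shift (suc d) c a = <ᵇ-shift d c a

  counted-shift : ∀ d k before a after →
    counted k (shift d before) (d + a) (shift d after) ≡ counted k before a after
  counted-shift d k before a after =
    cong₂ (λ c b → if (k ≤ᵇ c) ∧ not b then 1 else 0) larger (smaller before)
    where
    larger : count ((d + a) <?_) (shift d after) ≡ count (a <?_) after
    larger = trans (count-map ((d + a) <?_) (d +_) after)
                   (count-cong _ (a <?_) after (λ _ → +-cancelˡ-< d a _) (λ _ → +-monoʳ-< d))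
    smaller : ∀ bs → any (_<ᵇ d + a) (shift d bs) ≡ any (_<ᵇ a) bs
    smaller []       = refl
    smaller (c ∷ bs) = cong₂ _∨_ (<ᵇ-shift d c a) (smaller bs)

  mmpGo-shift : ∀ d k before σ → mmpGo k (shift d before) (shift d σ) ≡ mmpGo k before σ
  mmpGo-shift d k before []      = refl
  mmpGo-shift d k before (a ∷ σ) =
    cong₂ _+_ (counted-shift d k before a σ)
      (trans (cong (λ bs → mmpGo k bs (shift d σ)) (sym (map-++ (d +_) before [ a ])))
             (mmpGo-shift d k (before ++ [ a ]) σ))

  mmp-shift : ∀ d k σ → mmp k (shift d σ) ≡ mmp k σ
  mmp-shift d k σ = mmpGo-shift d k [] σ

  -- Inserting a maximum M between xs and ys, where every entry of xs
  -- exceeds every entry of ys: the entries of ys behave as in ys alone, the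
  -- entries of xs each gain one larger entry (M) to their right, and M is
  -- counted iff k = 0 and xs is empty.

  maxCounted : ℕ → List ℕ → ℕ
  maxCounted zero []      = 1
  maxCounted zero (_ ∷ _) = 0
  maxCounted (suc _) _    = 0

  -- The contribution of the entries before an inserted maximum.
  prefixStat : ℕ → List ℕ → ℕ
  prefixStat k xs = mmp (pred k) xs + maxCounted k xs

  prefixStat-shift : ∀ d k xs → prefixStat k (shift d xs) ≡ prefixStat k xs
  prefixStat-shift d k xs = cong₂ _+_ (mmp-shift d (pred k) xs) (maxCounted-shift k xs)
    where
    maxCounted-shift : ∀ k xs → maxCounted k (shift d xs) ≡ maxCounted k xs
    maxCounted-shift zero    []      = refl
    maxCounted-shift zero    (_ ∷ _) = refl
    maxCounted-shift (suc k) _       = refl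

  ≤ᵇ-pred : ∀ k c → (k ≤ᵇ suc c) ≡ (pred k ≤ᵇ c)
  ≤ᵇ-pred zero          c = refl
  ≤ᵇ-pred (suc zero)    c = refl
  ≤ᵇ-pred (suc (suc k)) c = refl

  count-larger : ∀ x xs M ys → x < M → (∀ {y} → y ∈ ys → y < x) →
    count (x <?_) (xs ++ M ∷ ys) ≡ suc (count (x <?_) xs)
  count-larger x xs M ys x<M ys<x = begin
    count (x <?_) (xs ++ M ∷ ys)               ≡⟨ count-++ (x <?_) xs (M ∷ ys) ⟩
    count (x <?_) xs + count (x <?_) (M ∷ ys)  ≡⟨ cong (count (x <?_) xs +_) only-M ⟩
    count (x <?_) xs + 1                       ≡⟨ +-comm (count (x <?_) xs) 1 ⟩
    suc (count (x <?_) xs)                     ∎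
    where
    open ≡-Reasoning
    only-M : count (x <?_) (M ∷ ys) ≡ 1
    only-M rewrite <ᵇ-true x<M = cong suc (count-none (x <?_) ys (λ y∈ x<y → <-asym x<y (ys<x y∈)))

  mmpGo-prefix : ∀ k before xs M ys → (∀ {x} → x ∈ xs → x < M) → (∀ {x y} → x ∈ xs → y ∈ ys → y < x) →
    mmpGo k before (xs ++ M ∷ ys) ≡ mmpGo (pred k) before xs + mmpGo k (before ++ xs) (M ∷ ys)
  mmpGo-prefix k before [] M ys _ _ = cong (λ bs → mmpGo k bs (M ∷ ys)) (sym (++-identityʳ before))
  mmpGo-prefix k before (x ∷ xs) M ys xs<M ys<xs
    rewrite count-larger x xs M ys (xs<M (here refl)) (ys<xs (here refl))
          | ≤ᵇ-pred k (count (x <?_) xs)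
          | mmpGo-prefix k (before ++ [ x ]) xs M ys (λ x∈ → xs<M (there x∈)) (λ x∈ → ys<xs (there x∈))
          | ++-assoc before [ x ] xs
    = sym (+-assoc (counted (pred k) before x xs) _ _)

  mmpGo-after-larger : ∀ k C D ys → (∀ {c y} → c ∈ C → y ∈ ys → y < c) → mmpGo k (C ++ D) ys ≡ mmpGo k D ys
  mmpGo-after-larger k C D []       _    = refl
  mmpGo-after-larger k C D (y ∷ ys) ys<C =
    cong₂ (λ b n → (if (k ≤ᵇ count (y <?_) ys) ∧ not b then 1 else 0) + n)
      (trans (any-++ C D) (cong (_∨ any (_<ᵇ y) D) (none-smaller C (λ c∈ → ys<C c∈ (here refl)))))
      (trans (cong (λ bs → mmpGo k bs ys) (++-assoc C D [ y ]))
             (mmpGo-after-larger k C (D ++ [ y ]) ys (λ c∈ y∈ → ys<C c∈ (there y∈))))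
    where
    any-++ : ∀ C D → any (_<ᵇ y) (C ++ D) ≡ any (_<ᵇ y) C ∨ any (_<ᵇ y) D
    any-++ []      D = refl
    any-++ (c ∷ C) D = trans (cong ((c <ᵇ y) ∨_) (any-++ C D)) (sym (∨-assoc (c <ᵇ y) _ _))
    none-smaller : ∀ C → (∀ {c} → c ∈ C → y < c) → any (_<ᵇ y) C ≡ false
    none-smaller []      _   = refl
    none-smaller (c ∷ C) y<C = cong₂ _∨_ (<ᵇ-false (y<C (here refl))) (none-smaller C (λ c∈ → y<C (there c∈)))

  mmp-insertMax : ∀ k xs M ys → (∀ {x} → x ∈ xs → x < M) → (∀ {y} → y ∈ ys → y < M) →
    (∀ {x y} → x ∈ xs → y ∈ ys → y < x) → mmp k (xs ++ M ∷ ys) ≡ prefixStat k xs + mmp k ys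
  mmp-insertMax k xs M ys xs<M ys<M ys<xs = begin
    mmpGo k [] (xs ++ M ∷ ys)
      ≡⟨ mmpGo-prefix k [] xs M ys xs<M ys<xs ⟩
    mmp (pred k) xs + (counted k xs M ys + mmpGo k (xs ++ [ M ]) ys)
      ≡⟨ cong (mmp (pred k) xs +_) (cong₂ _+_ (max-term k xs xs<M) ys-term) ⟩
    mmp (pred k) xs + (maxCounted k xs + mmp k ys)
      ≡⟨ +-assoc (mmp (pred k) xs) _ _ ⟨
    prefixStat k xs + mmp k ys ∎
    where
    open ≡-Reasoning
    no-larger : count (M <?_) ys ≡ 0
    no-larger = count-none (M <?_) ys (λ y∈ M<y → <-asym M<y (ys<M y∈))
    max-term : ∀ k xs → (∀ {x} → x ∈ xs → x < M) → counted k xs M ys ≡ maxCounted k xs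
    max-term k xs xs<M rewrite no-larger = by-cases k xs xs<M
      where
      by-cases : ∀ k xs → (∀ {x} → x ∈ xs → x < M) →
                 (if (k ≤ᵇ 0) ∧ not (any (_<ᵇ M) xs) then 1 else 0) ≡ maxCounted k xs
      by-cases zero    []       _    = refl
      by-cases zero    (x ∷ xs) xs<M rewrite <ᵇ-true (xs<M (here refl)) = refl
      by-cases (suc k) _        _    = refl
    ys-term : mmpGo k (xs ++ [ M ]) ys ≡ mmp k ys
    ys-term = trans (cong (λ bs → mmpGo k bs ys) (sym (++-identityʳ (xs ++ [ M ]))))
                    (mmpGo-after-larger k (xs ++ [ M ]) [] ys larger)
      where
      larger : ∀ {c y} → c ∈ xs ++ [ M ] → y ∈ ys → y < c
      larger c∈ y∈ with ∈-++⁻ xs c∈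
      ... | inj₁ c∈xs       = ys<xs c∈xs y∈
      ... | inj₂ (here refl) = ys<M y∈


-- The recurrence for the coefficients of Q k obtained from the
-- decomposition at the maximum.
module Recurrence where

  open import Defs using (Q; Σ≤; S132; mmp)
  open Sums
  open Counting
  open Pattern132 using (shift)
  open Arrangements using (range; ∈-S132⁻; unique-S132)
  open Decomposition
  open MmpSplit
  open import Data.Nat as ℕ using (ℕ; zero; suc; _∸_; _≤_; _<_; s≤s; _≟_; _≤?_)
  open import Data.Nat.Properties as ℕP using ()
  open import Data.Nat.ListAction using (sum)
  open import Data.Integer as ℤ using (ℤ; _+_; _*_; 0ℤ)
  open import Data.Integer.Properties as ℤP using ()
  open import Data.Bool using (true; false; if_then_else_)
  open import Data.List using (List; []; _∷_; map; applyUpTo; upTo; concatMap)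
  open import Data.List.Membership.Propositional using (_∈_)
  open import Data.List.Membership.Propositional.Properties using (∈-map⁻)
  open import Data.List.Relation.Unary.Any using (here; there)
  open import Data.Product using (_,_; proj₁; proj₂)
  open import Data.Sum using (inj₁; inj₂)
  open import Function.Bundles using (mk⇔)
  open import Relation.Nullary using (does; yes; no)
  open import Relation.Nullary.Decidable using (dec-true; dec-false)
  open import Relation.Unary using (Pred; Decidable)
  open import Level using (0ℓ)
  open import Relation.Binary.PropositionalEquality
  open ≡-Reasoning

  sum-cong : ∀ {A : Set} (f g : A → ℕ) xs → (∀ {x} → x ∈ xs → f x ≡ g x) → sum (map f xs) ≡ sum (map g xs)
  sum-cong f g []       _   = refl
  sum-cong f g (x ∷ xs) f≡g = cong₂ ℕ._+_ (f≡g (here refl)) (sum-cong f g xs (λ x∈ → f≡g (there x∈)))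

  sum-applyUpTo : ∀ n (g : ℕ → ℕ) (f : ℕ → ℕ) → ℤ.+ sum (map f (applyUpTo g (suc n))) ≡ Σ≤ n (λ i → ℤ.+ f (g i))
  sum-applyUpTo zero    g f = cong ℤ.+_ (ℕP.+-identityʳ (f (g 0)))
  sum-applyUpTo (suc n) g f = begin
    ℤ.+ (f (g 0) ℕ.+ sum (map f (applyUpTo (λ i → g (suc i)) (suc n))))
      ≡⟨ ℤP.pos-+ (f (g 0)) _ ⟩
    ℤ.+ f (g 0) + ℤ.+ sum (map f (applyUpTo (λ i → g (suc i)) (suc n)))
      ≡⟨ cong (ℤ.+ f (g 0) +_) (sum-applyUpTo n (λ i → g (suc i)) f) ⟩
    ℤ.+ f (g 0) + Σ≤ n (λ i → ℤ.+ f (g (suc i)))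
      ≡⟨ Σ-head n (λ i → ℤ.+ f (g i)) ⟨
    Σ≤ (suc n) (λ i → ℤ.+ f (g i)) ∎

  indicator : ℕ → ℕ → ℕ
  indicator c a = if does (c ≟ a) then 1 else 0

  indicator-≡ : ∀ c → indicator c c ≡ 1
  indicator-≡ c = cong (λ b → if b then 1 else 0) (dec-true (c ≟ c) refl)

  indicator-≢ : ∀ c a → c ≢ a → indicator c a ≡ 0
  indicator-≢ c a c≢a = cong (λ b → if b then 1 else 0) (dec-false (c ≟ a) c≢a)

  Σ-indicator-out : ∀ m c (w : ℕ → ℤ) → m < c → Σ≤ m (λ a → ℤ.+ indicator c a * w a) ≡ 0ℤ
  Σ-indicator-out m c w m<c =
    trans (Σ-cong m (λ a a≤m → trans (cong (λ z → ℤ.+ z * w a) (indicator-≢ c a (λ { refl → ℕP.<⇒≱ m<c a≤m })))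
                                     (ℤP.*-zeroˡ (w a))))
          (Σ-zero m (λ _ → 0ℤ) (λ _ → refl))

  Σ-indicator-in : ∀ m c (w : ℕ → ℤ) → c ≤ m → Σ≤ m (λ a → ℤ.+ indicator c a * w a) ≡ w c
  Σ-indicator-in zero .zero w ℕ.z≤n = trans (cong (λ z → ℤ.+ z * w 0) (indicator-≡ 0)) (ℤP.*-identityˡ (w 0))
  Σ-indicator-in (suc m) c w c≤1+m with ℕP.m≤n⇒m<n∨m≡n c≤1+m
  ... | inj₁ c<1+m = begin
    Σ≤ m (λ a → ℤ.+ indicator c a * w a) + ℤ.+ indicator c (suc m) * w (suc m)
      ≡⟨ cong₂ _+_ (Σ-indicator-in m c w (ℕP.≤-pred c<1+m))
                   (cong (λ z → ℤ.+ z * w (suc m)) (indicator-≢ c (suc m) (λ { refl → ℕP.<-irrefl refl c<1+m }))) ⟩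
    w c + ℤ.+ 0 * w (suc m)
      ≡⟨ cong (w c +_) (ℤP.*-zeroˡ (w (suc m))) ⟩
    w c + 0ℤ
      ≡⟨ ℤP.+-identityʳ (w c) ⟩
    w c ∎
  ... | inj₂ refl = begin
    Σ≤ m (λ a → ℤ.+ indicator c a * w a) + ℤ.+ indicator c c * w c
      ≡⟨ cong₂ _+_ (Σ-indicator-out m c w ℕP.≤-refl) (cong (λ z → ℤ.+ z * w c) (indicator-≡ c)) ⟩
    0ℤ + ℤ.+ 1 * w c
      ≡⟨ ℤP.+-identityˡ _ ⟩
    ℤ.+ 1 * w c
      ≡⟨ ℤP.*-identityˡ (w c) ⟩
    w c ∎

  count-∷ : ∀ {A : Set} (v : A → ℕ) a x xs → count (λ y → v y ≟ a) (x ∷ xs) ≡ indicator (v x) a ℕ.+ count (λ y → v y ≟ a) xs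
  count-∷ v a x xs with does (v x ≟ a)
  ... | true  = refl
  ... | false = refl

  sum-by-value : ∀ {A : Set} m (v : A → ℕ) (h : ℕ → ℕ) xs → (∀ c → m < c → h c ≡ 0) →
    ℤ.+ sum (map (λ x → h (v x)) xs) ≡ Σ≤ m (λ a → ℤ.+ count (λ x → v x ≟ a) xs * ℤ.+ h a)
  sum-by-value m v h []       _   = sym (Σ-zero m _ (λ a → ℤP.*-zeroˡ (ℤ.+ h a)))
  sum-by-value m v h (x ∷ xs) h≡0 = begin
    ℤ.+ (h (v x) ℕ.+ sum (map (λ x → h (v x)) xs))
      ≡⟨ ℤP.pos-+ (h (v x)) _ ⟩
    ℤ.+ h (v x) + ℤ.+ sum (map (λ x → h (v x)) xs)
      ≡⟨ cong₂ _+_ (sym select) (sum-by-value m v h xs h≡0) ⟩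
    Σ≤ m (λ a → ℤ.+ indicator (v x) a * ℤ.+ h a) + Σ≤ m (λ a → ℤ.+ count (λ x → v x ≟ a) xs * ℤ.+ h a)
      ≡⟨ Σ-+ m _ _ ⟨
    Σ≤ m (λ a → ℤ.+ indicator (v x) a * ℤ.+ h a + ℤ.+ count (λ x → v x ≟ a) xs * ℤ.+ h a)
      ≡⟨ Σ-cong′ m (λ a → trans (sym (ℤP.*-distribʳ-+ (ℤ.+ h a) (ℤ.+ indicator (v x) a) (ℤ.+ count (λ x → v x ≟ a) xs)))
                                 (cong (_* ℤ.+ h a) (trans (sym (ℤP.pos-+ (indicator (v x) a) (count (λ x → v x ≟ a) xs)))
                                                           (cong ℤ.+_ (sym (count-∷ v a x xs)))))) ⟩
    Σ≤ m (λ a → ℤ.+ count (λ x → v x ≟ a) (x ∷ xs) * ℤ.+ h a) ∎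
    where
    select : Σ≤ m (λ a → ℤ.+ indicator (v x) a * ℤ.+ h a) ≡ ℤ.+ h (v x)
    select with v x ≤? m
    ... | yes vx≤m = Σ-indicator-in m (v x) (λ a → ℤ.+ h a) vx≤m
    ... | no  vx≰m = trans (Σ-indicator-out m (v x) (λ a → ℤ.+ h a) (ℕP.≰⇒> vx≰m))
                           (cong ℤ.+_ (sym (h≡0 (v x) (ℕP.≰⇒> vx≰m))))

  -- The number of σ ∈ S_i(132) whose entries contribute a to mmp k once a
  -- larger maximum is placed after them.
  prefixCount : ℕ → ℕ → ℕ → ℕ
  prefixCount k i a = count (λ σ → prefixStat k σ ≟ a) (S132 i)

  count-S132-suc : ∀ {P : Pred (List ℕ) 0ℓ} (P? : Decidable P) n →
                   count P? (S132 (suc n)) ≡ count P? (decompositions n)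
  count-S132-suc P? n =
    count-unique-set P? (unique-S132 (suc n)) (unique-decompositions n)
      (mk⇔ (∈-decompositions⁺ n) (∈-decompositions⁻ n))

  mmp-candidate : ∀ k {n i xs ys} → i ≤ n → xs ∈ S132 i → ys ∈ S132 (n ∸ i) →
                  mmp k (insertMax n (n ∸ i) xs ys) ≡ prefixStat k xs ℕ.+ mmp k ys
  mmp-candidate k {n} {i} {xs} {ys} i≤n xs∈ ys∈ =
    trans (mmp-insertMax k (shift j xs) (suc n) ys xs<M ys<M ys<xs)
          (cong (ℕ._+ mmp k ys) (prefixStat-shift j k xs))
    where
    j = n ∸ i
    ys≤j : ∀ {y} → y ∈ ys → y ≤ j
    ys≤j y∈ = proj₂ (range (∈-S132⁻ j ys∈) y∈)
    xs<M : ∀ {x} → x ∈ shift j xs → x < suc n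
    xs<M x∈ with ∈-map⁻ (j ℕ.+_) x∈
    ... | a , a∈ , refl = s≤s (subst (j ℕ.+ a ≤_) (ℕP.m∸n+n≡m i≤n) (ℕP.+-monoʳ-≤ j (proj₂ (range (∈-S132⁻ i xs∈) a∈))))
    ys<M : ∀ {y} → y ∈ ys → y < suc n
    ys<M y∈ = s≤s (ℕP.≤-trans (ys≤j y∈) (ℕP.m∸n≤m n i))
    ys<xs : ∀ {x y} → x ∈ shift j xs → y ∈ ys → y < x
    ys<xs x∈ y∈ with ∈-map⁻ (j ℕ.+_) x∈
    ... | a , a∈ , refl = ℕP.≤-<-trans (ys≤j y∈) (ℕP.m<m+n j (proj₁ (range (∈-S132⁻ i xs∈) a∈)))

  count-block : ∀ k n m i → i ≤ n →
    ℤ.+ count (λ σ → mmp k σ ≟ m) (block n i) ≡ Σ≤ m (λ a → ℤ.+ prefixCount k i a * Q k (n ∸ i) (m ∸ a))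
  count-block k n m i i≤n = begin
    ℤ.+ count P (concatMap (λ xs → map (insertMax n j xs) Y) X)
      ≡⟨ cong ℤ.+_ (count-concatMap P (λ xs → map (insertMax n j xs) Y) X) ⟩
    ℤ.+ sum (map (λ xs → count P (map (insertMax n j xs) Y)) X)
      ≡⟨ cong ℤ.+_ (sum-cong _ _ X (λ xs∈ → by-prefix xs∈)) ⟩
    ℤ.+ sum (map (λ xs → h (prefixStat k xs)) X)
      ≡⟨ sum-by-value m (prefixStat k) h X h-vanishes ⟩
    Σ≤ m (λ a → ℤ.+ prefixCount k i a * ℤ.+ h a)
      ≡⟨ Σ-cong m (λ a a≤m → cong (λ z → ℤ.+ prefixCount k i a * ℤ.+ z) (h-remaining a≤m)) ⟩
    Σ≤ m (λ a → ℤ.+ prefixCount k i a * Q k j (m ∸ a)) ∎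
    where
    j = n ∸ i
    X = S132 i
    Y = S132 j
    P = λ σ → mmp k σ ≟ m
    h : ℕ → ℕ
    h c = count (λ ys → c ℕ.+ mmp k ys ≟ m) Y
    by-prefix : ∀ {xs} → xs ∈ X → count P (map (insertMax n j xs) Y) ≡ h (prefixStat k xs)
    by-prefix xs∈ = trans (count-map P (insertMax n j _) Y)
      (count-cong _ _ Y (λ ys∈ eq → trans (sym (mmp-candidate k i≤n xs∈ ys∈)) eq)
                        (λ ys∈ eq → trans (mmp-candidate k i≤n xs∈ ys∈) eq))
    h-vanishes : ∀ c → m < c → h c ≡ 0
    h-vanishes c m<c = count-none _ Y (λ _ eq → ℕP.<⇒≱ m<c (subst (c ≤_) eq (ℕP.m≤m+n c _)))
    h-remaining : ∀ {a} → a ≤ m → h a ≡ count (λ ys → mmp k ys ≟ m ∸ a) Y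
    h-remaining {a} a≤m = count-cong _ _ Y
      (λ _ eq → trans (sym (ℕP.m+n∸m≡n a _)) (cong (_∸ a) eq))
      (λ _ eq → trans (cong (a ℕ.+_) eq) (ℕP.m+[n∸m]≡n a≤m))

  Q-recurrence : ∀ k n m → Q k (suc n) m ≡ Σ≤ n (λ i → Σ≤ m (λ a → ℤ.+ prefixCount k i a * Q k (n ∸ i) (m ∸ a)))
  Q-recurrence k n m = begin
    ℤ.+ count P (S132 (suc n))
      ≡⟨ cong ℤ.+_ (count-S132-suc P n) ⟩
    ℤ.+ count P (concatMap (block n) (upTo (suc n)))
      ≡⟨ cong ℤ.+_ (count-concatMap P (block n) (upTo (suc n))) ⟩
    ℤ.+ sum (map (λ i → count P (block n i)) (upTo (suc n)))
      ≡⟨ sum-applyUpTo n (λ i → i) (λ i → count P (block n i)) ⟩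
    Σ≤ n (λ i → ℤ.+ count P (block n i))
      ≡⟨ Σ-cong n (count-block k n m) ⟩
    Σ≤ n (λ i → Σ≤ m (λ a → ℤ.+ prefixCount k i a * Q k (n ∸ i) (m ∸ a))) ∎
    where
    P = λ σ → mmp k σ ≟ m


module GeneratingFunctions where

  open import Defs
  open Sums
  open PowerSeries
  open Counting using (count; count-cong; count-none)
  open Arrangements using (length≡; ∈-S132⁻)
  open MmpSplit using (prefixStat)
  open Recurrence using (prefixCount; Q-recurrence)
  open import Data.Nat as ℕ using (ℕ; zero; suc; _∸_; _≟_)
  open import Data.Nat.Properties as ℕP using ()
  open import Data.Integer as ℤ using (ℤ; _+_; _*_; 0ℤ; 1ℤ)
  open import Data.Integer.Properties as ℤP using ()
  open import Data.Integer.Tactic.RingSolver using (solve-∀)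
  open import Data.List using (List; _∷_)
  open import Relation.Binary.PropositionalEquality

  t⊛-zero : ∀ G m → (tS ⊛ G) 0 m ≡ 0ℤ
  t⊛-zero G m = Σ-zero m _ (λ j → trans (cong (_* G 0 (m ∸ j)) (ℤP.*-zeroˡ (δ j))) (ℤP.*-zeroˡ (G 0 (m ∸ j))))

  t⊛-suc : ∀ G n m → (tS ⊛ G) (suc n) m ≡ G n m
  t⊛-suc G n m = trans (Σ-head n _) (trans (cong (_+ (one ⊛ G) n m) (t⊛-zero G m))
                   (trans (ℤP.+-identityˡ _) (⊛-identityˡ G n m)))

  prefixSeries : ℕ → PS
  prefixSeries k i a = ℤ.+ prefixCount k i a

  -- Q_k = 1 + t · P_k · Q_k, the recurrence from the position of the maximum.
  Q-functional-equation : ∀ k → Q k ≈ one ⊕ tS ⊛ (prefixSeries k ⊛ Q k)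
  Q-functional-equation k zero m = sym (begin
    one 0 m + (tS ⊛ (prefixSeries k ⊛ Q k)) 0 m   ≡⟨ cong (one 0 m +_) (t⊛-zero (prefixSeries k ⊛ Q k) m) ⟩
    one 0 m + 0ℤ                                ≡⟨ ℤP.+-identityʳ _ ⟩
    one 0 m                                     ≡⟨ empty-word m ⟩
    Q k 0 m                                     ∎)
    where
    open ≡-Reasoning
    empty-word : ∀ m → one 0 m ≡ Q k 0 m
    empty-word zero    = refl
    empty-word (suc m) = refl
  Q-functional-equation k (suc n) m = sym (begin
    δ (suc n) * δ m + (tS ⊛ (prefixSeries k ⊛ Q k)) (suc n) m
      ≡⟨ cong₂ _+_ (ℤP.*-zeroˡ (δ m)) (t⊛-suc (prefixSeries k ⊛ Q k) n m) ⟩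
    0ℤ + (prefixSeries k ⊛ Q k) n m
      ≡⟨ ℤP.+-identityˡ _ ⟩
    (prefixSeries k ⊛ Q k) n m
      ≡⟨ Q-recurrence k n m ⟨
    Q k (suc n) m ∎)
    where open ≡-Reasoning

  -- For k ≥ 1 the maximum itself never counts, so P_{k+1} = Q_k.
  prefixSeries-suc : ∀ k → prefixSeries (suc k) ≈ Q k
  prefixSeries-suc k i a = cong ℤ.+_ (count-cong _ _ (S132 i)
    (λ _ eq → trans (sym (ℕP.+-identityʳ _)) eq) (λ _ eq → trans (ℕP.+-identityʳ _) eq))

  -- For k = 0 the maximum counts iff it comes first, so P_0 = Q_0 - 1 + x.
  prefixSeries-zero : prefixSeries 0 ≈ Q 0 ⊖ one ⊕ xS
  prefixSeries-zero zero    zero          = refl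
  prefixSeries-zero zero    (suc zero)    = refl
  prefixSeries-zero zero    (suc (suc a)) = refl
  prefixSeries-zero (suc i) a = begin
    ℤ.+ count (λ σ → prefixStat 0 σ ≟ a) (S132 (suc i))
      ≡⟨ cong ℤ.+_ (count-cong _ _ (S132 (suc i)) (λ σ∈ eq → trans (sym (nonempty σ∈)) eq)
                                                 (λ σ∈ eq → trans (nonempty σ∈) eq)) ⟩
    Q 0 (suc i) a
      ≡⟨ ℤP.+-identityʳ _ ⟨
    Q 0 (suc i) a + 0ℤ
      ≡⟨ ℤP.+-identityʳ _ ⟨
    Q 0 (suc i) a + 0ℤ + 0ℤ
      ≡⟨ cong₂ (λ u v → Q 0 (suc i) a ℤ.- u + v) (ℤP.*-zeroˡ (δ a)) (ℤP.*-zeroˡ (δ₁ a)) ⟨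
    (Q 0 ⊖ one ⊕ xS) (suc i) a ∎
    where
    open ≡-Reasoning
    open import Data.List.Membership.Propositional using (_∈_)
    nonempty : ∀ {σ} → σ ∈ S132 (suc i) → prefixStat 0 σ ≡ mmp 0 σ
    nonempty {σ} σ∈ with σ | length≡ (∈-S132⁻ (suc i) σ∈)
    ... | _ ∷ _ | _ = ℕP.+-identityʳ _

  Q-suc-equation : ∀ k → Q (suc k) ≈ one ⊕ tS ⊛ (Q k ⊛ Q (suc k))
  Q-suc-equation k n m = trans (Q-functional-equation (suc k) n m)
    (cong (one n m +_) (⊛-cong {tS} {tS} (λ _ _ → refl)
                          (⊛-cong {G = Q (suc k)} (prefixSeries-suc k) (λ _ _ → refl)) n m))

  Q-zero-equation : Q 0 ≈ one ⊕ tS ⊛ ((Q 0 ⊖ one ⊕ xS) ⊛ Q 0)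
  Q-zero-equation n m = trans (Q-functional-equation 0 n m)
    (cong (one n m +_) (⊛-cong {tS} {tS} (λ _ _ → refl)
                          (⊛-cong {G = Q 0} prefixSeries-zero (λ _ _ → refl)) n m))

  ⊕-cancel : ∀ H {F G} → F ≈ G → H ⊕ (F ⊖ G) ≈ H
  ⊕-cancel H {F} {G} F≈G n m = begin
    H n m + (F n m ℤ.- G n m)   ≡⟨ cong (λ z → H n m + (F n m ℤ.- z)) (F≈G n m) ⟨
    H n m + (F n m ℤ.- F n m)   ≡⟨ cong (H n m +_) (ℤP.+-inverseʳ (F n m)) ⟩
    H n m + 0ℤ                  ≡⟨ ℤP.+-identityʳ (H n m) ⟩
    H n m                       ∎
    where open ≡-Reasoning

  ⊖-cancel : ∀ H C {F G} → F ≈ G → H ⊖ C ⊛ (F ⊖ G) ≈ H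
  ⊖-cancel H C {F} {G} F≈G n m = begin
    H n m ℤ.- (C ⊛ (F ⊖ G)) n m   ≡⟨ cong (λ z → H n m ℤ.- z) (Σ-zero n _ (λ i → Σ-zero m _ (λ j → vanish i j))) ⟩
    H n m ℤ.- 0ℤ                  ≡⟨ ℤP.+-identityʳ (H n m) ⟩
    H n m                         ∎
    where
    open ≡-Reasoning
    vanish : ∀ i j → C i j * (F ⊖ G) (n ∸ i) (m ∸ j) ≡ 0ℤ
    vanish i j = trans (cong (C i j *_) (trans (cong (λ z → F _ _ ℤ.- z) (sym (F≈G (n ∸ i) (m ∸ j))))
                                               (ℤP.+-inverseʳ (F (n ∸ i) (m ∸ j)))))
                       (ℤP.*-zeroʳ (C i j))

  geometric-identity : ∀ A B T → A ⊛ (one ⊖ T ⊛ B) ≈ one ⊕ (A ⊖ (one ⊕ T ⊛ (B ⊛ A)))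
  geometric-identity = solve 3 (λ A B T → A :* (con 1ℤ :- T :* B) := con 1ℤ :+ (A :- (con 1ℤ :+ T :* (B :* A))))
                               (λ n m → refl)

  inverse-of-geometric : ∀ A B → A ≈ one ⊕ tS ⊛ (B ⊛ A) → A ⊛ (one ⊖ tS ⊛ B) ≈ one
  inverse-of-geometric A B A≈ = ≈-trans (geometric-identity A B tS) (⊕-cancel one A≈)

  -- The square root for k = 0: with b = 1 + t - tx, the series b - 2t·Q₀
  -- squares to b² - 4t because t·Q₀² - b·Q₀ + 1 = 0.
  b : PS
  b = one ⊕ tS ⊖ tS ⊛ xS

  sqrtSeries : PS
  sqrtSeries = b ⊖ two ⊛ tS ⊛ Q 0

  square-identity : ∀ T X Q →
    ((one ⊕ T ⊖ T ⊛ X) ⊖ two ⊛ T ⊛ Q) ⊛ ((one ⊕ T ⊖ T ⊛ X) ⊖ two ⊛ T ⊛ Q)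
    ≈ ((one ⊕ T ⊖ T ⊛ X) ⊛ (one ⊕ T ⊖ T ⊛ X) ⊖ two ⊛ two ⊛ T)
      ⊖ (two ⊛ two ⊛ T) ⊛ (Q ⊖ (one ⊕ T ⊛ ((Q ⊖ one ⊕ X) ⊛ Q)))
  square-identity = solve 3 (λ T X Q →
      ((c1 :+ T :- T :* X) :- c2 :* T :* Q) :* ((c1 :+ T :- T :* X) :- c2 :* T :* Q)
      := ((c1 :+ T :- T :* X) :* (c1 :+ T :- T :* X) :- c2 :* c2 :* T)
         :- (c2 :* c2 :* T) :* (Q :- (c1 :+ T :* ((Q :- c1 :+ X) :* Q))))
    (λ n m → refl)
    where
    c1 = con 1ℤ
    c2 = con 1ℤ :+ con 1ℤ

  row0-⊛ : ∀ F G m → (∀ j → F 0 j ≡ 0ℤ) → (F ⊛ G) 0 m ≡ 0ℤ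
  row0-⊛ F G m F0≡0 = Σ-zero m _ (λ j → trans (cong (_* G 0 (m ∸ j)) (F0≡0 j)) (ℤP.*-zeroˡ (G 0 (m ∸ j))))

  sqrt-constant : ∀ m → sqrtSeries 0 m ≡ one 0 m
  sqrt-constant m = begin
    (one 0 m + tS 0 m ℤ.- (tS ⊛ xS) 0 m) ℤ.- (two ⊛ tS ⊛ Q 0) 0 m
      ≡⟨ cong₂ (λ u v → (one 0 m + u ℤ.- (tS ⊛ xS) 0 m) ℤ.- v) (ℤP.*-zeroˡ (δ m)) 2tQ-row0 ⟩
    (one 0 m + 0ℤ ℤ.- (tS ⊛ xS) 0 m) ℤ.- 0ℤ
      ≡⟨ cong (λ u → (one 0 m + 0ℤ ℤ.- u) ℤ.- 0ℤ) (t⊛-zero xS m) ⟩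
    (one 0 m + 0ℤ ℤ.- 0ℤ) ℤ.- 0ℤ
      ≡⟨ drop-zeros (one 0 m) ⟩
    one 0 m ∎
    where
    open ≡-Reasoning
    2tQ-row0 : (two ⊛ tS ⊛ Q 0) 0 m ≡ 0ℤ
    2tQ-row0 = row0-⊛ (two ⊛ tS) (Q 0) m (λ j → trans (⊛-comm two tS 0 j) (t⊛-zero two j))
    drop-zeros : ∀ a → (a + 0ℤ ℤ.- 0ℤ) ℤ.- 0ℤ ≡ a
    drop-zeros = solve-∀

  sqrt-square : sqrtSeries ⊛ sqrtSeries ≈ b ⊛ b ⊖ two ⊛ two ⊛ tS
  sqrt-square = ≈-trans (square-identity tS xS (Q 0)) (⊖-cancel _ (two ⊛ two ⊛ tS) Q-zero-equation)

  Q0-formula : two ⊛ tS ⊛ Q 0 ≈ b ⊖ sqrtSeries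
  Q0-formula n m = subtract-twice (b n m) ((two ⊛ tS ⊛ Q 0) n m)
    where
    subtract-twice : ∀ u v → v ≡ u ℤ.- (u ℤ.- v)
    subtract-twice = solve-∀

  atx0-cong : ∀ {F G} → F ≈ G → atx0 F ≈ atx0 G
  atx0-cong F≈G n m = cong (_* δ m) (F≈G n 0)

  atx0-⊕ : ∀ F G → atx0 (F ⊕ G) ≈ atx0 F ⊕ atx0 G
  atx0-⊕ F G n m = ℤP.*-distribʳ-+ (δ m) (F n 0) (G n 0)

  atx0-one : atx0 one ≈ one
  atx0-one n m = cong (_* δ m) (ℤP.*-identityʳ (δ n))

  atx0-tS : atx0 tS ≈ tS
  atx0-tS n m = cong (_* δ m) (ℤP.*-identityʳ (δ₁ n))

  atx0-⊛ : ∀ F G → atx0 (F ⊛ G) ≈ atx0 F ⊛ atx0 G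
  atx0-⊛ F G n m = trans (Σ-*ʳ n (δ m) (λ i → F i 0 * G (n ∸ i) 0))
                         (Σ-cong′ n (λ i → sym (only-x⁰ (F i 0) (G (n ∸ i) 0))))
    where
    rearrange : ∀ u v x y → (u * x) * (v * y) ≡ x * (u * (v * y))
    rearrange = solve-∀
    only-x⁰ : ∀ u v → Σ≤ m (λ j → (u * δ j) * (v * δ (m ∸ j))) ≡ (u * v) * δ m
    only-x⁰ u v = trans (Σ-cong′ m (λ j → rearrange u v (δ j) (δ (m ∸ j))))
                        (trans (Σ-δ m (λ j → u * (v * δ (m ∸ j)))) (sym (ℤP.*-assoc u v (δ m))))

  -- Every nonempty permutation has a left-to-right minimum (its first entry).
  Q0-at-x0 : atx0 (Q 0) ≈ one
  Q0-at-x0 zero    m = refl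
  Q0-at-x0 (suc n) m = cong (λ c → ℤ.+ c * δ m) (count-none _ (S132 (suc n)) has-lr-minimum)
    where
    open import Data.List.Membership.Propositional using (_∈_)
    has-lr-minimum : ∀ {σ} → σ ∈ S132 (suc n) → mmp 0 σ ≢ 0
    has-lr-minimum {σ} σ∈ with σ | length≡ (∈-S132⁻ (suc n) σ∈)
    ... | _ ∷ _ | _ = λ ()

  Q-suc-at-x0 : ∀ k → atx0 (Q (suc k)) ⊛ (one ⊖ tS ⊛ atx0 (Q k)) ≈ one
  Q-suc-at-x0 k = inverse-of-geometric (atx0 (Q (suc k))) (atx0 (Q k)) λ n m → begin
    atx0 (Q (suc k)) n m
      ≡⟨ atx0-cong (Q-suc-equation k) n m ⟩
    atx0 (one ⊕ tS ⊛ (Q k ⊛ Q (suc k))) n m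
      ≡⟨ atx0-⊕ one (tS ⊛ (Q k ⊛ Q (suc k))) n m ⟩
    atx0 one n m + atx0 (tS ⊛ (Q k ⊛ Q (suc k))) n m
      ≡⟨ cong₂ _+_ (atx0-one n m) (atx0-⊛ tS (Q k ⊛ Q (suc k)) n m) ⟩
    one n m + (atx0 tS ⊛ atx0 (Q k ⊛ Q (suc k))) n m
      ≡⟨ cong (one n m +_) (⊛-cong {atx0 tS} {tS} {atx0 (Q k ⊛ Q (suc k))} atx0-tS (atx0-⊛ (Q k) (Q (suc k))) n m) ⟩
    one n m + (tS ⊛ (atx0 (Q k) ⊛ atx0 (Q (suc k)))) n m ∎
    where open ≡-Reasoning


open GeneratingFunctions

theorem21 :
    (∃ λ (Sq : PS) →
        (∀ m → Sq 0 m ≡ one 0 m)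
      × (Sq ⊛ Sq ≈ (one ⊕ tS ⊖ tS ⊛ xS) ⊛ (one ⊕ tS ⊖ tS ⊛ xS) ⊖ two ⊛ two ⊛ tS)
      × (two ⊛ tS ⊛ Q 0 ≈ (one ⊕ tS ⊖ tS ⊛ xS) ⊖ Sq))
    × (∀ (k : ℕ) → Q (suc k) ⊛ (one ⊖ tS ⊛ Q k) ≈ one)
    × (atx0 (Q 0) ≈ one)
    × (∀ (k : ℕ) → atx0 (Q (suc k)) ⊛ (one ⊖ tS ⊛ atx0 (Q k)) ≈ one)
theorem21 =
    (sqrtSeries , sqrt-constant , sqrt-square , Q0-formula)
  , (λ k → inverse-of-geometric (Q (suc k)) (Q k) (Q-suc-equation k))
  , Q0-at-x0
  , Q-suc-at-x0
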